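{- The polytope $P=P_n(123,132)$ is a combinatorial cube with Ehrhart polynomial \[ |mP\cap\mathbb{Z}^n| =\frac{m + 1}{(n-1)!}\prod_{j=2}^{n-1}{(nm + j)}. \]
   Context: $P_n(123,132)=\operatorname{conv}\{(a_1,\dots,a_n)\in\mathbb{R}^n : a_1\cdots a_n\in\mathfrak{S}_n$ avoids both patterns $123$ and $132\}$. A combinatorial cube is a polytope whose face lattice is isomorphic to that of a cube.
   Formalization: The linear functionals exposing faces of P and of the cube have rational coefficients and values, and the convex combinations defining mP have rational rather than real weights. -}

module Defs where

open import Data.Nat as ℕ using (ℕ; zero; suc; _∸_)

open import Data.Integer as ℤ using (ℤ; +_)
open import Data.Rational as ℚ using (ℚ; 0ℚ; 1ℚ)
open import Data.Fin as Fin using (Fin)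
open import Data.Vec as Vec using (Vec; lookup; zipWith; map)
open import Data.Bool using (Bool; true; false)
open import Data.List as List using (List; length)
open import Data.List.Relation.Unary.All using (All)
open import Data.Nat.ListAction using (product)
open import Data.List.Relation.Unary.Unique.Propositional using (Unique)
open import Data.List.Membership.Propositional using (_∈_)
open import Data.Product using (Σ; ∃; ∃-syntax; _×_; _,_; proj₁; proj₂)
open import Data.Empty using (⊥)
open import Relation.Nullary using (¬_)
open import Relation.Binary.PropositionalEquality using (_≡_)
open import Function.Bundles using (_⇔_)
open import Level using (Level; suc; 0ℓ)

ℕ→ℚ : ℕ → ℚ
ℕ→ℚ k = (+ k) ℚ./ 1

ℤ→ℚ : ℤ → ℚ
ℤ→ℚ z = z ℚ./ 1

sumℚ : ∀ {d} → Vec ℚ d → ℚ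
sumℚ = Vec.foldr _ ℚ._+_ 0ℚ

_·_ : ∀ {d} → Vec ℚ d → Vec ℚ d → ℚ
c · x = sumℚ (zipWith ℚ._*_ c x)

IsPerm : ∀ {n} → Vec ℕ n → Set
IsPerm {n} a =
  (∀ i → 1 ℕ.≤ lookup a i × lookup a i ℕ.≤ n) ×
  (∀ i j → lookup a i ≡ lookup a j → i ≡ j)

Avoids123 : ∀ {n} → Vec ℕ n → Set
Avoids123 a = ∀ i j k → i Fin.< j → j Fin.< k →
  ¬ (lookup a i ℕ.< lookup a j × lookup a j ℕ.< lookup a k)

Avoids132 : ∀ {n} → Vec ℕ n → Set
Avoids132 a = ∀ i j k → i Fin.< j → j Fin.< k →
  ¬ (lookup a i ℕ.< lookup a k × lookup a k ℕ.< lookup a j)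

IsGen : ∀ {n} → Vec ℕ n → Set
IsGen a = IsPerm a × Avoids123 a × Avoids132 a

toℚv : ∀ {n} → Vec ℕ n → Vec ℚ n
toℚv = map ℕ→ℚ

-- A set S of generating points of a
-- polytope Q = conv(Gen) is the vertex set of a face of Q iff there is a
-- linear functional c and a value b with c·v ≤ b on all of Gen and
-- equality exactly on S.  (c = 0, b = 0 gives Q; c = 0, b = 1 gives ∅.)

IsPFace : ∀ {n} → (Vec ℕ n → Set) → Set
IsPFace {n} S = ∃[ c ] ∃[ b ]
  ((∀ a → IsGen a → c · toℚv a ℚ.≤ b) ×
   (∀ a → IsGen a → (S a ⇔ (c · toℚv a ≡ b))))

cubePt : ∀ {d} → Vec Bool d → Vec ℚ d
cubePt = map (λ { true → 1ℚ ; false → 0ℚ })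

IsCubeFace : ∀ {d} → (Vec Bool d → Set) → Set
IsCubeFace {d} S = ∃[ c ] ∃[ b ]
  ((∀ e → c · cubePt e ℚ.≤ b) ×
   (∀ e → (S e ⇔ (c · cubePt e ≡ b))))

image : ∀ {n d} → (Vec Bool d → Vec ℕ n) → (Vec Bool d → Set) → Vec ℕ n → Set
image φ S a = ∃[ e ] (S e × φ e ≡ a)

-- P_n(123,132) is a combinatorial cube: for some d there is a bijection φ
-- from the vertices of [0,1]^d onto the generating points (= vertices) of P
-- carrying vertex sets of faces exactly to vertex sets of faces.  This is
-- an isomorphism of face lattices (faces ordered by inclusion of vertex sets).
IsCombCube : ℕ → Set₁
IsCombCube n = ∃[ d ] Σ (Vec Bool d → Vec ℕ n) λ φ →
  (∀ e → IsGen (φ e)) ×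
  (∀ a → IsGen a → ∃[ e ] φ e ≡ a) ×
  (∀ e e′ → φ e ≡ φ e′ → e ≡ e′) ×
  (∀ (S : Vec Bool d → Set) → IsCubeFace S ⇔ IsPFace (image φ S))

-- Lattice points of mP: x ∈ ℤ^n lies in mP iff x is a convex combination
-- (rational weights) of the points m·a, a generating.

weightedSum : ∀ {n} → ℕ → List (Vec ℕ n × ℚ) → Vec ℚ n
weightedSum {n} m List.[] = Vec.replicate n 0ℚ
weightedSum m ((a , w) List.∷ ws) =
  zipWith ℚ._+_ (map (λ t → w ℚ.* (ℕ→ℚ m ℚ.* t)) (toℚv a)) (weightedSum m ws)

weightTotal : ∀ {n} → List (Vec ℕ n × ℚ) → ℚ
weightTotal = List.foldr (λ p s → proj₂ p ℚ.+ s) 0ℚ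

InDilate : ∀ {n} → ℕ → Vec ℤ n → Set
InDilate {n} m x = ∃[ ws ]
  (All (λ p → IsGen (proj₁ p)) ws ×
   All (λ p → 0ℚ ℚ.≤ proj₂ p) ws ×
   weightTotal ws ≡ 1ℚ ×
   weightedSum m ws ≡ map ℤ→ℚ x)

LatticeCount : ℕ → ℕ → ℕ → Set
LatticeCount n m N = ∃[ L ]
  (Unique {A = Vec ℤ n} L ×
   (∀ x → x ∈ L ⇔ InDilate m x) ×
   length L ≡ N)

ehrProd : ℕ → ℕ → ℕ
ehrProd n m = product (List.map (λ j → n ℕ.* m ℕ.+ j)
                                     (List.drop 2 (List.upTo n)))

{-# OPTIONS --safe #-}
module Submission where

-- A permutation avoids 123 and 132 exactly when each entry is the largest or the second
-- largest of the entries from its position on.  Recording this choice at the first n − 1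
-- positions identifies the vertices of P with those of the cube {0,1}^(n−1).  A linear
-- functional c is maximised over these vertices exactly at the choices whose i-th bit
-- follows the sign of c_i − max_{j>i} c_j, every sign vector arises, and on the cube the
-- maximisers of r are likewise read off the signs of r; so both polytopes have the same
-- faces.  Coordinate by coordinate, mP is cut out by m·(n − 1) ≤ z₁ ≤ M (starting from
-- M = m·n) together with the same constraints on the remaining coordinates for the top
-- value M + m·(n − 1) − z₁; conversely every such point is the mean of the vertices under
-- independent choices with suitable probabilities.  Counting the lattice points first
-- coordinate by first coordinate gives a recurrence in n and M solved by the product formula.

module Rationals where

  open import Defs using (ℕ→ℚ)
  open import Data.Nat as ℕ using (ℕ; zero; suc)
  import Data.Nat.Properties as ℕ
  import Data.Integer as ℤ
  import Data.Integer.Properties as ℤ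
  open import Data.Rational as ℚ using (ℚ; mkℚ; 0ℚ; 1ℚ; _+_; _*_; _-_; -_; _≤_; _<_; *≤*; *<*)
  import Data.Rational.Properties as ℚ
  import Data.Nat.Coprimality as Coprime
  open import Data.Rational.Solver using (module +-*-Solver)
  open +-*-Solver
  open import Data.Product using (_×_; _,_)
  open import Data.Empty using (⊥-elim)
  open import Relation.Nullary using (Dec; yes; no; ¬_)
  open import Function.Bundles using (_⇔_; mk⇔; Equivalence)
  open import Algebra.Properties.Group ℚ.+-0-group using (∙-cancelˡ)
  open import Relation.Binary.PropositionalEquality

  ℕ→ℚ-mkℚ : ∀ k → ℕ→ℚ k ≡ mkℚ (ℤ.+ k) 0 (Coprime.sym (Coprime.1-coprimeTo k))
  ℕ→ℚ-mkℚ k = ℚ.normalize-coprime (Coprime.sym (Coprime.1-coprimeTo k))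

  ℕ→ℚ-suc : ∀ k → ℕ→ℚ (suc k) ≡ 1ℚ + ℕ→ℚ k
  ℕ→ℚ-suc k = sym (trans (cong (1ℚ +_) (ℕ→ℚ-mkℚ k))
    (cong (λ t → (ℤ.+ 1 ℤ.+ t) ℚ./ 1) (ℤ.*-identityʳ (ℤ.+ k))))

  ℕ→ℚ-+ : ∀ a b → ℕ→ℚ (a ℕ.+ b) ≡ ℕ→ℚ a + ℕ→ℚ b
  ℕ→ℚ-+ zero    b = sym (ℚ.+-identityˡ (ℕ→ℚ b))
  ℕ→ℚ-+ (suc a) b = begin
    ℕ→ℚ (suc (a ℕ.+ b))        ≡⟨ ℕ→ℚ-suc (a ℕ.+ b) ⟩
    1ℚ + ℕ→ℚ (a ℕ.+ b)         ≡⟨ cong (1ℚ +_) (ℕ→ℚ-+ a b) ⟩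
    1ℚ + (ℕ→ℚ a + ℕ→ℚ b)       ≡⟨ ℚ.+-assoc 1ℚ (ℕ→ℚ a) (ℕ→ℚ b) ⟨
    (1ℚ + ℕ→ℚ a) + ℕ→ℚ b       ≡⟨ cong (_+ ℕ→ℚ b) (ℕ→ℚ-suc a) ⟨
    ℕ→ℚ (suc a) + ℕ→ℚ b        ∎
    where open ≡-Reasoning

  ℕ→ℚ-* : ∀ a b → ℕ→ℚ (a ℕ.* b) ≡ ℕ→ℚ a * ℕ→ℚ b
  ℕ→ℚ-* zero    b = sym (ℚ.*-zeroˡ (ℕ→ℚ b))
  ℕ→ℚ-* (suc a) b = begin
    ℕ→ℚ (b ℕ.+ a ℕ.* b)          ≡⟨ ℕ→ℚ-+ b (a ℕ.* b) ⟩
    ℕ→ℚ b + ℕ→ℚ (a ℕ.* b)        ≡⟨ cong (ℕ→ℚ b +_) (ℕ→ℚ-* a b) ⟩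
    ℕ→ℚ b + ℕ→ℚ a * ℕ→ℚ b        ≡⟨ solve 2 (λ x y → y :+ x :* y := (con 1ℚ :+ x) :* y) refl (ℕ→ℚ a) (ℕ→ℚ b) ⟩
    (1ℚ + ℕ→ℚ a) * ℕ→ℚ b         ≡⟨ cong (_* ℕ→ℚ b) (ℕ→ℚ-suc a) ⟨
    ℕ→ℚ (suc a) * ℕ→ℚ b          ∎
    where open ≡-Reasoning

  ℕ→ℚ-mono-≤ : ∀ {a b} → a ℕ.≤ b → ℕ→ℚ a ≤ ℕ→ℚ b
  ℕ→ℚ-mono-≤ {a} {b} a≤b = subst₂ _≤_ (sym (ℕ→ℚ-mkℚ a)) (sym (ℕ→ℚ-mkℚ b))
    (*≤* (subst₂ ℤ._≤_ (sym (ℤ.*-identityʳ (ℤ.+ a))) (sym (ℤ.*-identityʳ (ℤ.+ b))) (ℤ.+≤+ a≤b)))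

  ℕ→ℚ-mono-< : ∀ {a b} → a ℕ.< b → ℕ→ℚ a < ℕ→ℚ b
  ℕ→ℚ-mono-< {a} {b} a<b = subst₂ _<_ (sym (ℕ→ℚ-mkℚ a)) (sym (ℕ→ℚ-mkℚ b))
    (*<* (subst₂ ℤ._<_ (sym (ℤ.*-identityʳ (ℤ.+ a))) (sym (ℤ.*-identityʳ (ℤ.+ b))) (ℤ.+<+ a<b)))

  ℕ→ℚ-cancel-≤ : ∀ {a b} → ℕ→ℚ a ≤ ℕ→ℚ b → a ℕ.≤ b
  ℕ→ℚ-cancel-≤ h = ℕ.≮⇒≥ (λ b<a → ℚ.<-irrefl refl (ℚ.≤-<-trans h (ℕ→ℚ-mono-< b<a)))

  ℕ→ℚ-nonNeg : ∀ k → 0ℚ ≤ ℕ→ℚ k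
  ℕ→ℚ-nonNeg k = ℕ→ℚ-mono-≤ {0} {k} ℕ.z≤n

  ℕ→ℚ-injective : ∀ {a b} → ℕ→ℚ a ≡ ℕ→ℚ b → a ≡ b
  ℕ→ℚ-injective eq =
    ℕ.≤-antisym (ℕ→ℚ-cancel-≤ (ℚ.≤-reflexive eq)) (ℕ→ℚ-cancel-≤ (ℚ.≤-reflexive (sym eq)))

  p≤q⇔0≤q-p : ∀ {p q} → p ≤ q ⇔ 0ℚ ≤ q - p
  p≤q⇔0≤q-p {p} {q} = mk⇔
    (λ p≤q → subst (_≤ q - p) (ℚ.+-inverseʳ p) (ℚ.+-monoˡ-≤ (- p) p≤q))
    (λ 0≤q-p → subst₂ _≤_ (ℚ.+-identityˡ p) (solve 2 (λ p q → (q :- p) :+ p := q) refl p q)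
                  (ℚ.+-monoˡ-≤ p 0≤q-p))

  p≤q⇔p-q≤0 : ∀ {p q} → p ≤ q ⇔ p - q ≤ 0ℚ
  p≤q⇔p-q≤0 {p} {q} = mk⇔
    (λ p≤q → subst (p - q ≤_) (ℚ.+-inverseʳ q) (ℚ.+-monoˡ-≤ (- q) p≤q))
    (λ p-q≤0 → subst₂ _≤_ (solve 2 (λ p q → (p :- q) :+ q := p) refl p q) (ℚ.+-identityˡ q)
                  (ℚ.+-monoˡ-≤ q p-q≤0))

  <⇒0<-  : ∀ {p q} → p < q → 0ℚ < q - p
  <⇒0<- {p} {q} p<q = subst (_< q - p) (ℚ.+-inverseʳ p) (ℚ.+-monoˡ-< (- p) p<q)

  rearrangement : ∀ {a b x y} → a < b → x < y → a * y + b * x < a * x + b * y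
  rearrangement {a} {b} {x} {y} a<b x<y = subst (a * y + b * x <_)
    (solve 4 (λ a b x y → (a :* y :+ b :* x) :+ (b :- a) :* (y :- x) := a :* x :+ b :* y) refl a b x y)
    (subst (_< a * y + b * x + (b - a) * (y - x)) (ℚ.+-identityʳ (a * y + b * x))
      (ℚ.+-monoʳ-< (a * y + b * x) (ℚ.positive⁻¹ _ {{ℚ.pos*pos⇒pos (b - a) {{ℚ.positive (<⇒0<- a<b)}}
                                                                    (y - x) {{ℚ.positive (<⇒0<- x<y)}}}})))

  Tight : ℚ → ℚ → Set → Set
  Tight x X P = x ≤ X × (x ≡ X ⇔ P)

  tight-dec : ∀ {x X P} → Dec P → (P → x ≡ X) → (¬ P → x < X) → Tight x X P
  tight-dec (yes p) x≡X _   = ℚ.≤-reflexive (x≡X p) , mk⇔ (λ _ → p) (λ _ → x≡X p)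
  tight-dec (no ¬p) _   x<X =
    ℚ.<⇒≤ (x<X ¬p) , mk⇔ (λ x≡X → ⊥-elim (ℚ.<⇒≢ (x<X ¬p) x≡X)) (λ p → ⊥-elim (¬p p))

  tight-+ : ∀ h {x X O P Q} → Tight x X P → Tight (h + X) O Q → Tight (h + x) O (Q × P)
  tight-+ h {x} {X} {O} {P} {Q} (x≤X , x≡X⇔P) (hX≤O , hX≡O⇔Q) = hx≤O , mk⇔ equal⇒ ⇒equal
    where
    open Equivalence
    hx≤hX = ℚ.+-monoʳ-≤ h x≤X
    hx≤O = ℚ.≤-trans hx≤hX hX≤O
    equal⇒ : h + x ≡ O → Q × P
    equal⇒ hx≡O = to hX≡O⇔Q (trans (sym hx≡hX) hx≡O) , to x≡X⇔P (∙-cancelˡ h x X hx≡hX)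
      where hx≡hX = ℚ.≤-antisym hx≤hX (subst (h + X ≤_) (sym hx≡O) hX≤O)
    ⇒equal : Q × P → h + x ≡ O
    ⇒equal (q , p) = trans (cong (h +_) (from x≡X⇔P p)) (from hX≡O⇔Q q)

module Generators where

  open import Defs using (IsGen; Avoids123; Avoids132)
  open import Data.Nat as ℕ using (ℕ; zero; suc; _≤_; _<_; z≤n; s≤s; _⊓_; _∸_)
  import Data.Nat.Properties as ℕ
  open import Data.Fin as Fin using (Fin; fromℕ<) renaming (zero to fz; suc to fs)
  import Data.Fin.Properties as Fin
  open import Data.Vec as Vec using (Vec; []; _∷_; lookup)
  import Data.Vec.Properties as Vec
  open import Data.Bool using (Bool; true; false)
  open import Data.Product using (∃; _×_; _,_; proj₁; proj₂)
  open import Data.Sum using (_⊎_; inj₁; inj₂)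
  open import Data.Empty using (⊥; ⊥-elim)
  open import Function using (id; _∘_)
  open import Relation.Nullary using (yes; no)
  open import Relation.Binary.Definitions using (tri<; tri≈; tri>)
  open import Relation.Binary.PropositionalEquality

  gen : {A : Set} → (ℕ → A) → ∀ k → A → Vec Bool k → Vec A (suc k)
  gen κ zero    top []          = top ∷ []
  gen κ (suc k) top (true ∷ e)  = top ∷ gen κ k (κ (suc k)) e
  gen κ (suc k) top (false ∷ e) = κ (suc k) ∷ gen κ k top e

  map-gen : ∀ {A B : Set} (f : A → B) (κ : ℕ → A) k top e →
    Vec.map f (gen κ k top e) ≡ gen (f ∘ κ) k (f top) e
  map-gen f κ zero    top []          = refl
  map-gen f κ (suc k) top (true ∷ e)  = cong (f top ∷_) (map-gen f κ k (κ (suc k)) e)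
  map-gen f κ (suc k) top (false ∷ e) = cong (f (κ (suc k)) ∷_) (map-gen f κ k top e)

  word : ∀ k → ℕ → Vec Bool k → Vec ℕ (suc k)
  word = gen id

  InRange : ℕ → ℕ → ℕ → Set
  InRange k M x = (1 ≤ x × x ≤ k) ⊎ x ≡ M

  DistinctEntries : ∀ {L} → Vec ℕ L → Set
  DistinctEntries a = ∀ i j → lookup a i ≡ lookup a j → i ≡ j

  NoTwoLargerAfter : ∀ {L} → Vec ℕ L → Set
  NoTwoLargerAfter a = ∀ i j l → i Fin.< j → j Fin.< l →
    lookup a i < lookup a j → lookup a i < lookup a l → ⊥

  inRange-≤ : ∀ {k M x} → k < M → InRange k M x → x ≤ M
  inRange-≤ k<M (inj₁ (_ , x≤k)) = ℕ.≤-trans x≤k (ℕ.<⇒≤ k<M)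
  inRange-≤ k<M (inj₂ refl)      = ℕ.≤-refl

  inRange-≢ : ∀ {k M x y} → k < x → x ≢ M → InRange k M y → y ≢ x
  inRange-≢ k<x x≢M (inj₁ (_ , y≤k)) refl = ℕ.<⇒≱ k<x y≤k
  inRange-≢ k<x x≢M (inj₂ refl)      refl = x≢M refl

  word-inRange : ∀ k M e → k < M → ∀ i → InRange k M (lookup (word k M e) i)
  word-inRange zero    M []          k<M fz     = inj₂ refl
  word-inRange (suc k) M (true ∷ e)  k<M fz     = inj₂ refl
  word-inRange (suc k) M (false ∷ e) k<M fz     = inj₁ (s≤s z≤n , ℕ.≤-refl)
  word-inRange (suc k) M (true ∷ e)  k<M (fs i) with word-inRange k (suc k) e ℕ.≤-refl i
  ... | inj₁ (1≤x , x≤k) = inj₁ (1≤x , ℕ.m≤n⇒m≤1+n x≤k)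
  ... | inj₂ x≡k+1       = inj₁ (subst (1 ≤_) (sym x≡k+1) (s≤s z≤n) , ℕ.≤-reflexive x≡k+1)
  word-inRange (suc k) M (false ∷ e) k<M (fs i) with word-inRange k M e (ℕ.<⇒≤ k<M) i
  ... | inj₁ (1≤x , x≤k) = inj₁ (1≤x , ℕ.m≤n⇒m≤1+n x≤k)
  ... | inj₂ x≡M         = inj₂ x≡M

  word-head-fresh : ∀ k M b e → suc k < M → ∀ j →
    lookup (word (suc k) M (b ∷ e)) (fs j) ≢ lookup (word (suc k) M (b ∷ e)) fz
  word-head-fresh k M true  e k+1<M j =
    inRange-≢ (ℕ.<⇒≤ k+1<M) (ℕ.>⇒≢ k+1<M) (word-inRange k (suc k) e ℕ.≤-refl j)
  word-head-fresh k M false e k+1<M j =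
    inRange-≢ (ℕ.n<1+n k) (ℕ.<⇒≢ k+1<M) (word-inRange k M e (ℕ.<⇒≤ k+1<M) j)

  word-distinct : ∀ k M e → k < M → DistinctEntries (word k M e)
  word-distinct zero    M []          k<M fz     fz     _  = refl
  word-distinct (suc k) M (b ∷ e)     k<M fz     fz     _  = refl
  word-distinct (suc k) M (b ∷ e)     k<M fz     (fs j) eq = ⊥-elim (word-head-fresh k M b e k<M j (sym eq))
  word-distinct (suc k) M (b ∷ e)     k<M (fs i) fz     eq = ⊥-elim (word-head-fresh k M b e k<M i eq)
  word-distinct (suc k) M (true ∷ e)  k<M (fs i) (fs j) eq =
    cong fs (word-distinct k (suc k) e ℕ.≤-refl i j eq)
  word-distinct (suc k) M (false ∷ e) k<M (fs i) (fs j) eq =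
    cong fs (word-distinct k M e (ℕ.<⇒≤ k<M) i j eq)

  inRange-above : ∀ {k M y} → k < y → InRange k M y → y ≡ M
  inRange-above k<y (inj₁ (_ , y≤k)) = ⊥-elim (ℕ.<⇒≱ k<y y≤k)
  inRange-above k<y (inj₂ y≡M)       = y≡M

  word-noTwoLargerAfter : ∀ k M e → k < M → NoTwoLargerAfter (word k M e)
  word-noTwoLargerAfter zero    M []          k<M fz     fz     _      ()
  word-noTwoLargerAfter (suc k) M (b ∷ e)     k<M fz     fz     _      ()
  word-noTwoLargerAfter (suc k) M (true ∷ e)  k<M fz     (fs j) l      _       _       M<y _ =
    ℕ.<⇒≱ M<y (ℕ.≤-trans (inRange-≤ (ℕ.n<1+n k) (word-inRange k (suc k) e ℕ.≤-refl j)) (ℕ.<⇒≤ k<M))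
  word-noTwoLargerAfter (suc k) M (false ∷ e) k<M fz     (fs j) (fs l) _       (s≤s j<l) k+1<y k+1<z =
    ℕ.<-irrefl (cong Fin.toℕ j≡l) j<l
    where
    k<M′ = ℕ.<⇒≤ k<M
    j≡l = word-distinct k M e k<M′ j l
      (trans (inRange-above (ℕ.<⇒≤ k+1<y) (word-inRange k M e k<M′ j))
        (sym (inRange-above (ℕ.<⇒≤ k+1<z) (word-inRange k M e k<M′ l))))
  word-noTwoLargerAfter (suc k) M (true ∷ e)  k<M (fs i) (fs j) (fs l) (s≤s i<j) (s≤s j<l) =
    word-noTwoLargerAfter k (suc k) e ℕ.≤-refl i j l i<j j<l
  word-noTwoLargerAfter (suc k) M (false ∷ e) k<M (fs i) (fs j) (fs l) (s≤s i<j) (s≤s j<l) =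
    word-noTwoLargerAfter k M e (ℕ.<⇒≤ k<M) i j l i<j j<l

  word-injective : ∀ k M e e′ → k < M → word k M e ≡ word k M e′ → e ≡ e′
  word-injective zero    M []          []           k<M eq = refl
  word-injective (suc k) M (true ∷ e)  (true ∷ e′)  k<M eq =
    cong (true ∷_) (word-injective k (suc k) e e′ ℕ.≤-refl (Vec.∷-injectiveʳ eq))
  word-injective (suc k) M (false ∷ e) (false ∷ e′) k<M eq =
    cong (false ∷_) (word-injective k M e e′ (ℕ.<⇒≤ k<M) (Vec.∷-injectiveʳ eq))
  word-injective (suc k) M (true ∷ e)  (false ∷ e′) k<M eq = ⊥-elim (ℕ.>⇒≢ k<M (Vec.∷-injectiveˡ eq))
  word-injective (suc k) M (false ∷ e) (true ∷ e′)  k<M eq = ⊥-elim (ℕ.<⇒≢ k<M (Vec.∷-injectiveˡ eq))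

  -- Pigeonhole on v j ↦ min (v j) x − 1 ∈ Fin x: entries below x are distinct and
  -- keep their value, so two colliding entries must both lie above x.
  twoEntriesAbove : ∀ {L} x (v : Vec ℕ L) → 1 ≤ x → x < L → (∀ j → 1 ≤ lookup v j) →
    (∀ j → lookup v j ≢ x) → DistinctEntries v →
    ∃ λ j → ∃ λ l → j Fin.< l × x < lookup v j × x < lookup v l
  twoEntriesAbove {L} x@(suc _) v _ x<L positive ≢x distinct = fromCollision (Fin.pigeonhole x<L slot)
    where
    slot< : ∀ j → lookup v j ⊓ x ∸ 1 < x
    slot< j = s≤s (ℕ.∸-monoˡ-≤ 1 (ℕ.m⊓n≤n (lookup v j) x))
    slot : Fin L → Fin x
    slot j = fromℕ< (slot< j)
    fromCollision : ∃ (λ i → ∃ λ j → i Fin.< j × slot i ≡ slot j) →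
      ∃ λ j → ∃ λ l → j Fin.< l × x < lookup v j × x < lookup v l
    fromCollision (i , j , i<j , slot≡) = compare (ℕ.<-cmp x (lookup v i)) (ℕ.<-cmp x (lookup v j))
      where
      min≡ : lookup v i ⊓ x ≡ lookup v j ⊓ x
      min≡ = ℕ.∸-cancelʳ-≡ (ℕ.⊓-glb (positive i) (s≤s z≤n)) (ℕ.⊓-glb (positive j) (s≤s z≤n))
               (Fin.fromℕ<-injective _ _ (slot< i) (slot< j) slot≡)
      below : ∀ {y} → y < x → y ⊓ x ≡ y
      below y<x = ℕ.m≤n⇒m⊓n≡m (ℕ.<⇒≤ y<x)
      above : ∀ {y} → x < y → y ⊓ x ≡ x
      above x<y = ℕ.m≥n⇒m⊓n≡n (ℕ.<⇒≤ x<y)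
      compare : _ → _ → ∃ λ j → ∃ λ l → j Fin.< l × x < lookup v j × x < lookup v l
      compare (tri< x<vi _ _) (tri< x<vj _ _) = i , j , i<j , x<vi , x<vj
      compare (tri≈ _ x≡vi _) _               = ⊥-elim (≢x i (sym x≡vi))
      compare _               (tri≈ _ x≡vj _) = ⊥-elim (≢x j (sym x≡vj))
      compare (tri< x<vi _ _) (tri> _ _ vj<x) = ⊥-elim (≢x j (trans (sym (below vj<x)) (trans (sym min≡) (above x<vi))))
      compare (tri> _ _ vi<x) (tri< x<vj _ _) = ⊥-elim (≢x i (trans (sym (below vi<x)) (trans min≡ (above x<vj))))
      compare (tri> _ _ vi<x) (tri> _ _ vj<x) =
        ⊥-elim (ℕ.<⇒≢ i<j (cong Fin.toℕ (distinct i j (trans (sym (below vi<x)) (trans min≡ (below vj<x))))))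

  inRange-below-top : ∀ {k M y} → InRange (suc k) M y → y ≢ M → InRange k (suc k) y
  inRange-below-top (inj₁ (1≤y , y≤k+1)) _ with ℕ.m≤n⇒m<n∨m≡n y≤k+1
  ... | inj₁ y<k+1 = inj₁ (1≤y , ℕ.s≤s⁻¹ y<k+1)
  ... | inj₂ y≡k+1 = inj₂ y≡k+1
  inRange-below-top (inj₂ y≡M) y≢M = ⊥-elim (y≢M y≡M)

  inRange-drop-last : ∀ {k M y} → InRange (suc k) M y → y ≢ suc k → InRange k M y
  inRange-drop-last (inj₁ (1≤y , y≤k+1)) y≢k+1 = inj₁ (1≤y , ℕ.s≤s⁻¹ (ℕ.≤∧≢⇒< y≤k+1 y≢k+1))
  inRange-drop-last (inj₂ y≡M)           _     = inj₂ y≡M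

  inRange-positive : ∀ {k M y} → 1 ≤ M → InRange k M y → 1 ≤ y
  inRange-positive _   (inj₁ (1≤y , _)) = 1≤y
  inRange-positive 1≤M (inj₂ refl)      = 1≤M

  word-surjective : ∀ k M (a : Vec ℕ (suc k)) → k < M → (∀ i → InRange k M (lookup a i)) →
    DistinctEntries a → NoTwoLargerAfter a → ∃ λ e → word k M e ≡ a
  word-surjective zero M (x ∷ []) k<M range distinct _ with range fz
  ... | inj₁ (1≤x , x≤0) = ⊥-elim (ℕ.<⇒≱ 1≤x x≤0)
  ... | inj₂ x≡M         = [] , cong (_∷ []) (sym x≡M)
  word-surjective (suc k) M (x ∷ a) k<M range distinct noTwo = headCases (range fz)
    where
    distinct′ : DistinctEntries a
    distinct′ i j eq = Fin.suc-injective (distinct (fs i) (fs j) eq)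
    noTwo′ : NoTwoLargerAfter a
    noTwo′ i j l i<j j<l = noTwo (fs i) (fs j) (fs l) (s≤s i<j) (s≤s j<l)
    fresh : ∀ j → lookup a j ≢ x
    fresh j eq with () ← distinct fz (fs j) (sym eq)
    headCases : InRange (suc k) M x → ∃ λ e → word (suc k) M e ≡ x ∷ a
    headCases (inj₂ x≡M) =
      let e , eq = word-surjective k (suc k) a ℕ.≤-refl
                     (λ i → inRange-below-top (range (fs i)) (λ y≡M → fresh i (trans y≡M (sym x≡M))))
                     distinct′ noTwo′
      in true ∷ e , cong₂ _∷_ (sym x≡M) eq
    headCases (inj₁ (1≤x , x≤k+1)) with x ℕ.≟ suc k
    ... | yes x≡k+1 =
      let e , eq = word-surjective k M a (ℕ.<⇒≤ k<M)
                     (λ i → inRange-drop-last (range (fs i)) (λ y≡k+1 → fresh i (trans y≡k+1 (sym x≡k+1))))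
                     distinct′ noTwo′
      in false ∷ e , cong₂ _∷_ (sym x≡k+1) eq
    ... | no x≢k+1 =
      let j , l , j<l , x<aj , x<al = twoEntriesAbove x a 1≤x (ℕ.≤∧≢⇒< x≤k+1 x≢k+1)
            (λ j → inRange-positive (ℕ.≤-trans (s≤s z≤n) k<M) (range (fs j))) fresh distinct′
      in ⊥-elim (noTwo fz (fs j) (fs l) (s≤s z≤n) (s≤s j<l) x<aj x<al)

  toPerm : ∀ d → Vec Bool d → Vec ℕ (suc d)
  toPerm d = word d (suc d)

  toPerm-isGen : ∀ d e → IsGen (toPerm d e)
  toPerm-isGen d e = (bounds , word-distinct d (suc d) e ℕ.≤-refl) , avoids123 , avoids132
    where
    bounds : ∀ i → 1 ≤ lookup (toPerm d e) i × lookup (toPerm d e) i ≤ suc d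
    bounds i = inRange-positive (s≤s z≤n) range , inRange-≤ (ℕ.n<1+n d) range
      where range = word-inRange d (suc d) e ℕ.≤-refl i
    noTwo = word-noTwoLargerAfter d (suc d) e ℕ.≤-refl
    avoids123 : Avoids123 (toPerm d e)
    avoids123 i j l i<j j<l (ai<aj , aj<al) = noTwo i j l i<j j<l ai<aj (ℕ.<-trans ai<aj aj<al)
    avoids132 : Avoids132 (toPerm d e)
    avoids132 i j l i<j j<l (ai<al , al<aj) = noTwo i j l i<j j<l (ℕ.<-trans ai<al al<aj) ai<al

  toPerm-surjective : ∀ d a → IsGen {suc d} a → ∃ λ e → toPerm d e ≡ a
  toPerm-surjective d a ((bounds , distinct) , avoids123 , avoids132) =
    word-surjective d (suc d) a ℕ.≤-refl range distinct noTwo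
    where
    range : ∀ i → InRange d (suc d) (lookup a i)
    range i with lookup a i ℕ.≤? d
    ... | yes ai≤d = inj₁ (proj₁ (bounds i) , ai≤d)
    ... | no  ai≰d = inj₂ (ℕ.≤-antisym (proj₂ (bounds i)) (ℕ.≰⇒> ai≰d))
    noTwo : NoTwoLargerAfter a
    noTwo i j l i<j j<l ai<aj ai<al with ℕ.<-cmp (lookup a j) (lookup a l)
    ... | tri< aj<al _ _ = avoids123 i j l i<j j<l (ai<aj , aj<al)
    ... | tri> _ _ al<aj = avoids132 i j l i<j j<l (ai<al , al<aj)
    ... | tri≈ _ aj≡al _ = ℕ.<⇒≢ j<l (cong Fin.toℕ (distinct j l aj≡al))

  toPerm-injective : ∀ d e e′ → toPerm d e ≡ toPerm d e′ → e ≡ e′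
  toPerm-injective d e e′ = word-injective d (suc d) e e′ ℕ.≤-refl

module Faces where

  open import Defs using (_·_; cubePt; toℚv; ℕ→ℚ; IsGen; IsPFace; image; IsCombCube)
  open Rationals
  open Generators
  open import Data.Nat as ℕ using (ℕ; zero; suc)
  import Data.Nat.Properties as ℕ
  open import Data.Rational as ℚ using (ℚ; 0ℚ; 1ℚ; _+_; _*_; _-_; _≤_; _<_; _⊔_; _⊓_)
  import Data.Rational.Properties as ℚ
  open import Data.Rational.Solver using (module +-*-Solver)
  open +-*-Solver
  open import Data.Vec as Vec using (Vec; []; _∷_)
  open import Data.Bool using (Bool; true; false)
  open import Data.Product using (∃; ∃-syntax; _×_; _,_; proj₁; proj₂)
  open import Data.Unit using (⊤; tt)
  open import Data.Empty using (⊥-elim)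
  open import Data.Sum using (_⊎_; inj₁; inj₂)
  open import Function using (_∘_)
  open import Function.Bundles using (_⇔_; mk⇔; Equivalence)
  import Function.Properties.Equivalence as ⇔
  open import Relation.Nullary using (yes; no; ¬_)
  open import Relation.Binary.PropositionalEquality

  open Equivalence

  Pattern : ∀ {k} → Vec ℚ k → Vec Bool k → Set
  Pattern []       []          = ⊤
  Pattern (r ∷ rs) (true ∷ e)  = 0ℚ ≤ r × Pattern rs e
  Pattern (r ∷ rs) (false ∷ e) = r ≤ 0ℚ × Pattern rs e

  pattern-nonempty : ∀ {k} (r : Vec ℚ k) → ∃ (Pattern r)
  pattern-nonempty []       = [] , tt
  pattern-nonempty (r ∷ rs) with 0ℚ ℚ.≤? r | pattern-nonempty rs
  ... | yes 0≤r | e , p = true ∷ e , 0≤r , p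
  ... | no  0≰r | e , p = false ∷ e , ℚ.<⇒≤ (ℚ.≰⇒> 0≰r) , p

  cubeOptimum : ∀ {k} → Vec ℚ k → ℚ
  cubeOptimum []       = 0ℚ
  cubeOptimum (r ∷ rs) = (r ⊔ 0ℚ) + cubeOptimum rs

  cube-optimum : ∀ {k} (r : Vec ℚ k) e → Tight (r · cubePt e) (cubeOptimum r) (Pattern r e)
  cube-optimum []       []          = ℚ.≤-refl , mk⇔ (λ _ → tt) (λ _ → refl)
  cube-optimum (r ∷ rs) (true ∷ e)  =
    tight-+ (r * 1ℚ) (cube-optimum rs e) (tight-dec (0ℚ ℚ.≤? r) equal strict)
    where
    equal : 0ℚ ≤ r → r * 1ℚ + cubeOptimum rs ≡ (r ⊔ 0ℚ) + cubeOptimum rs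
    equal 0≤r = cong (_+ cubeOptimum rs) (trans (ℚ.*-identityʳ r) (sym (ℚ.p≥q⇒p⊔q≡p 0≤r)))
    strict : ¬ 0ℚ ≤ r → r * 1ℚ + cubeOptimum rs < (r ⊔ 0ℚ) + cubeOptimum rs
    strict 0≰r = ℚ.+-monoˡ-< (cubeOptimum rs) (subst₂ _<_ (sym (ℚ.*-identityʳ r))
      (sym (ℚ.p≤q⇒p⊔q≡q (ℚ.<⇒≤ (ℚ.≰⇒> 0≰r)))) (ℚ.≰⇒> 0≰r))
  cube-optimum (r ∷ rs) (false ∷ e) =
    tight-+ (r * 0ℚ) (cube-optimum rs e) (tight-dec (r ℚ.≤? 0ℚ) equal strict)
    where
    equal : r ≤ 0ℚ → r * 0ℚ + cubeOptimum rs ≡ (r ⊔ 0ℚ) + cubeOptimum rs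
    equal r≤0 = cong (_+ cubeOptimum rs) (trans (ℚ.*-zeroʳ r) (sym (ℚ.p≤q⇒p⊔q≡q r≤0)))
    strict : ¬ r ≤ 0ℚ → r * 0ℚ + cubeOptimum rs < (r ⊔ 0ℚ) + cubeOptimum rs
    strict r≰0 = ℚ.+-monoˡ-< (cubeOptimum rs) (subst₂ _<_ (sym (ℚ.*-zeroʳ r))
      (sym (ℚ.p≥q⇒p⊔q≡p (ℚ.<⇒≤ (ℚ.≰⇒> r≰0)))) (ℚ.≰⇒> r≰0))

  vmax : ∀ {k} → Vec ℚ (suc k) → ℚ
  vmax {zero}  (c ∷ [])  = c
  vmax {suc k} (c ∷ cs) = c ⊔ vmax cs

  excesses : ∀ {k} → Vec ℚ (suc k) → Vec ℚ k
  excesses {zero}  (c ∷ [])  = []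
  excesses {suc k} (c ∷ cs) = (c - vmax cs) ∷ excesses cs

  -- Maximising c over the points gen κ k top e puts top where c is largest;
  -- belowTop κ c collects the contribution of the remaining values κ j.
  belowTop : (ℕ → ℚ) → ∀ {k} → Vec ℚ (suc k) → ℚ
  belowTop κ {zero}  (c ∷ [])  = 0ℚ
  belowTop κ {suc k} (c ∷ cs) = belowTop κ cs + κ (suc k) * (c ⊓ vmax cs)

  optimum : (ℕ → ℚ) → ∀ {k} → Vec ℚ (suc k) → ℚ → ℚ
  optimum κ c top = belowTop κ c + top * vmax c

  module _ (κ : ℕ → ℚ) {k} (c : ℚ) (cs : Vec ℚ (suc k)) {top} (K<top : κ (suc k) < top) where
    private
      K = κ (suc k)
      v = vmax cs
      W = belowTop κ cs

      optimum-cons : ∀ {lo hi} → c ⊓ v ≡ lo → c ⊔ v ≡ hi →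
        optimum κ (c ∷ cs) top ≡ (W + K * lo) + top * hi
      optimum-cons refl refl = refl

    topFirst-tight : Tight (c * top + optimum κ cs K) (optimum κ (c ∷ cs) top) (0ℚ ≤ c - v)
    topFirst-tight = tight-dec (0ℚ ℚ.≤? c - v) equal strict
      where
      equal : 0ℚ ≤ c - v → c * top + optimum κ cs K ≡ optimum κ (c ∷ cs) top
      equal 0≤c-v = sym (trans (optimum-cons (ℚ.p≥q⇒p⊓q≡q v≤c) (ℚ.p≥q⇒p⊔q≡p v≤c))
        (solve 5 (λ W K top c v → (W :+ K :* v) :+ top :* c := c :* top :+ (W :+ K :* v)) refl W K top c v))
        where v≤c = from p≤q⇔0≤q-p 0≤c-v
      strict : ¬ 0ℚ ≤ c - v → c * top + optimum κ cs K < optimum κ (c ∷ cs) top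
      strict 0≰c-v = subst₂ _<_
        (solve 5 (λ W K top c v → (c :* top :+ v :* K) :+ W := c :* top :+ (W :+ K :* v)) refl W K top c v)
        (sym (trans (optimum-cons (ℚ.p≤q⇒p⊓q≡p (ℚ.<⇒≤ c<v)) (ℚ.p≤q⇒p⊔q≡q (ℚ.<⇒≤ c<v)))
          (solve 5 (λ W K top c v → (W :+ K :* c) :+ top :* v := (c :* K :+ v :* top) :+ W) refl W K top c v)))
        (ℚ.+-monoˡ-< W (rearrangement c<v K<top))
        where c<v = ℚ.≰⇒> (0≰c-v ∘ to p≤q⇔0≤q-p)

    secondFirst-tight : Tight (c * K + optimum κ cs top) (optimum κ (c ∷ cs) top) (c - v ≤ 0ℚ)
    secondFirst-tight = tight-dec (c - v ℚ.≤? 0ℚ) equal strict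
      where
      equal : c - v ≤ 0ℚ → c * K + optimum κ cs top ≡ optimum κ (c ∷ cs) top
      equal c-v≤0 = sym (trans (optimum-cons (ℚ.p≤q⇒p⊓q≡p c≤v) (ℚ.p≤q⇒p⊔q≡q c≤v))
        (solve 5 (λ W K top c v → (W :+ K :* c) :+ top :* v := c :* K :+ (W :+ top :* v)) refl W K top c v))
        where c≤v = from p≤q⇔p-q≤0 c-v≤0
      strict : ¬ c - v ≤ 0ℚ → c * K + optimum κ cs top < optimum κ (c ∷ cs) top
      strict c-v≰0 = subst₂ _<_
        (solve 5 (λ W K top c v → (v :* top :+ c :* K) :+ W := c :* K :+ (W :+ top :* v)) refl W K top c v)
        (sym (trans (optimum-cons (ℚ.p≥q⇒p⊓q≡q (ℚ.<⇒≤ v<c)) (ℚ.p≥q⇒p⊔q≡p (ℚ.<⇒≤ v<c)))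
          (solve 5 (λ W K top c v → (W :+ K :* v) :+ top :* c := (v :* K :+ c :* top) :+ W) refl W K top c v)))
        (ℚ.+-monoˡ-< W (rearrangement v<c K<top))
        where v<c = ℚ.≰⇒> (c-v≰0 ∘ to p≤q⇔p-q≤0)

  gen-optimum : ∀ κ → (∀ j → κ j < κ (suc j)) → ∀ k (c : Vec ℚ (suc k)) top e → κ k < top →
    Tight (c · gen κ k top e) (optimum κ c top) (Pattern (excesses c) e)
  gen-optimum κ κ-inc zero    (c ∷ [])     top []          _ =
    ℚ.≤-reflexive c*top+0≡0+top*c , mk⇔ (λ _ → tt) (λ _ → c*top+0≡0+top*c)
    where c*top+0≡0+top*c = solve 2 (λ c top → c :* top :+ con 0ℚ := con 0ℚ :+ top :* c) refl c top
  gen-optimum κ κ-inc (suc k) (c ∷ cs) top (true ∷ e) Kk+1<top =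
    tight-+ (c * top) (gen-optimum κ κ-inc k cs (κ (suc k)) e (κ-inc k)) (topFirst-tight κ c cs Kk+1<top)
  gen-optimum κ κ-inc (suc k) (c ∷ cs) top (false ∷ e) Kk+1<top =
    tight-+ (c * κ (suc k)) (gen-optimum κ κ-inc k cs top e (ℚ.<-trans (κ-inc k) Kk+1<top))
      (secondFirst-tight κ c cs Kk+1<top)

  IsFaceOf : ∀ {X : Set} {a} → (X → Vec ℚ a) → (X → Set) → Set
  IsFaceOf p S = ∃[ c ] ∃[ b ] ((∀ x → c · p x ≤ b) × (∀ x → S x ⇔ (c · p x ≡ b)))

  record PatternOptima {k a} (p : Vec Bool k → Vec ℚ a) : Set where
    field
      patternOf          : Vec ℚ a → Vec ℚ k
      optimumOf          : Vec ℚ a → ℚ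
      tight              : ∀ c e → Tight (c · p e) (optimumOf c) (Pattern (patternOf c) e)
      functional         : Vec ℚ k → Vec ℚ a
      pattern-functional : ∀ r → patternOf (functional r) ≡ r

  zero-· : ∀ {a} (x : Vec ℚ a) → Vec.replicate a 0ℚ · x ≡ 0ℚ
  zero-· []       = refl
  zero-· (x ∷ xs) = trans (cong₂ _+_ (ℚ.*-zeroˡ x) (zero-· xs)) (ℚ.+-identityˡ 0ℚ)

  empty-isFace : ∀ {X : Set} {a} (p : X → Vec ℚ a) {S : X → Set} → (∀ x → ¬ S x) → IsFaceOf p S
  empty-isFace {a = a} p S-empty = Vec.replicate a 0ℚ , 1ℚ ,
    (λ x → subst (_≤ 1ℚ) (sym (zero-· (p x))) (ℚ.<⇒≤ (ℚ.positive⁻¹ 1ℚ))) ,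
    (λ x → mk⇔ (⊥-elim ∘ S-empty x) (λ 0≡1 → ⊥-elim (ℚ.1≢0 (sym (trans (sym (zero-· (p x))) 0≡1)))))

  module _ {k a} {p : Vec Bool k → Vec ℚ a} (O : PatternOptima p) where
    open PatternOptima O

    pattern-isFace : ∀ r {S : Vec Bool k → Set} → (∀ e → S e ⇔ Pattern r e) → IsFaceOf p S
    pattern-isFace r S⇔ = c , optimumOf c , (λ e → proj₁ (tight c e)) ,
      λ e → ⇔.trans (S⇔ e) (subst (λ r′ → Pattern r′ e ⇔ (c · p e ≡ optimumOf c)) (pattern-functional r)
                                  (⇔.sym (proj₂ (tight c e))))
      where c = functional r

    face-isPattern : ∀ {S} → IsFaceOf p S → (∃ λ r → ∀ e → S e ⇔ Pattern r e) ⊎ (∀ e → ¬ S e)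
    face-isPattern (c , b , bounded , S⇔) with b ℚ.≟ optimumOf c
    ... | yes refl  = inj₁ (patternOf c , λ e → ⇔.trans (S⇔ e) (proj₂ (tight c e)))
    ... | no  b≢opt = inj₂ λ e Se → b≢opt (ℚ.≤-antisym
          (subst (_≤ optimumOf c) (to (S⇔ e) Se) (proj₁ (tight c e)))
          (subst (_≤ b) (from (proj₂ (tight c e*)) pe*) (bounded e*)))
      where e* = proj₁ (pattern-nonempty (patternOf c))
            pe* = proj₂ (pattern-nonempty (patternOf c))

  faces-agree : ∀ {k a a′} {p : Vec Bool k → Vec ℚ a} {q : Vec Bool k → Vec ℚ a′} {S} →
    PatternOptima p → PatternOptima q → IsFaceOf p S → IsFaceOf q S
  faces-agree {q = q} Op Oq face with face-isPattern Op face
  ... | inj₁ (r , S⇔) = pattern-isFace Oq r S⇔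
  ... | inj₂ S-empty  = empty-isFace q S-empty

  cube-patternOptima : ∀ {k} → PatternOptima (cubePt {k})
  cube-patternOptima = record
    { patternOf = λ r → r ; optimumOf = cubeOptimum ; tight = cube-optimum
    ; functional = λ r → r ; pattern-functional = λ _ → refl }

  withExcesses : ∀ {k} → Vec ℚ k → Vec ℚ (suc k)
  withExcesses []       = 0ℚ ∷ []
  withExcesses (r ∷ rs) = (r + vmax (withExcesses rs)) ∷ withExcesses rs

  excesses-withExcesses : ∀ {k} (r : Vec ℚ k) → excesses (withExcesses r) ≡ r
  excesses-withExcesses []       = refl
  excesses-withExcesses (r ∷ rs) = cong₂ _∷_
    (solve 2 (λ r v → (r :+ v) :- v := r) refl r (vmax (withExcesses rs))) (excesses-withExcesses rs)

  toPerm-optimum : ∀ d c e →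
    Tight (c · toℚv (toPerm d e)) (optimum ℕ→ℚ c (ℕ→ℚ (suc d))) (Pattern (excesses c) e)
  toPerm-optimum d c e =
    subst (λ x → Tight (c · x) (optimum ℕ→ℚ c (ℕ→ℚ (suc d))) (Pattern (excesses c) e))
      (sym (map-gen ℕ→ℚ (λ i → i) d (suc d) e))
      (gen-optimum ℕ→ℚ (λ j → ℕ→ℚ-mono-< (ℕ.n<1+n j)) d c _ e (ℕ→ℚ-mono-< (ℕ.n<1+n d)))

  perm-patternOptima : ∀ d → PatternOptima (toℚv ∘ toPerm d)
  perm-patternOptima d = record
    { patternOf = excesses ; optimumOf = λ c → optimum ℕ→ℚ c (ℕ→ℚ (suc d)) ; tight = toPerm-optimum d
    ; functional = withExcesses ; pattern-functional = excesses-withExcesses }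

  image-toPerm : ∀ d {S : Vec Bool d → Set} e → image (toPerm d) S (toPerm d e) ⇔ S e
  image-toPerm d {S} e =
    mk⇔ (λ (e′ , Se′ , eq) → subst S (toPerm-injective d e′ e eq) Se′) (λ Se → e , Se , refl)

  isPFace-image⇔ : ∀ d {S : Vec Bool d → Set} →
    IsPFace (image (toPerm d) S) ⇔ IsFaceOf (toℚv ∘ toPerm d) S
  isPFace-image⇔ d {S} = mk⇔
    (λ (c , b , bounded , S⇔) → c , b , (λ e → bounded _ (toPerm-isGen d e)) ,
      λ e → ⇔.trans (⇔.sym (image-toPerm d e)) (S⇔ _ (toPerm-isGen d e)))
    (λ (c , b , bounded , S⇔) → c , b , overGens (λ e → bounded e) ,
      overGens (λ e → ⇔.trans (image-toPerm d e) (S⇔ e)))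
    where
    overGens : ∀ {P : Vec ℕ (suc d) → Set} → (∀ e → P (toPerm d e)) → ∀ a → IsGen a → P a
    overGens P-toPerm a isGen with e , refl ← toPerm-surjective d a isGen = P-toPerm e

  toPerm-isCombCube : ∀ d → IsCombCube (suc d)
  toPerm-isCombCube d = d , toPerm d , toPerm-isGen d , toPerm-surjective d , toPerm-injective d ,
    λ S → mk⇔ (from (isPFace-image⇔ d) ∘ faces-agree cube-patternOptima (perm-patternOptima d))
              (faces-agree (perm-patternOptima d) cube-patternOptima ∘ to (isPFace-image⇔ d))

module Dilates where

  open import Defs using (ℕ→ℚ; ℤ→ℚ; toℚv; IsGen; weightedSum; weightTotal; InDilate)
  open Rationals
  open Generators
  open import Data.Nat as ℕ using (ℕ; zero; suc)
  import Data.Nat.Properties as ℕ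
  open import Data.Integer using (ℤ)
  open import Data.Rational as ℚ using (ℚ; 0ℚ; 1ℚ; _+_; _*_; _-_; -_; _≤_; _<_; 1/_)
  import Data.Rational.Properties as ℚ
  open import Data.Rational.Solver using (module +-*-Solver)
  open +-*-Solver
  open import Data.Vec as Vec using (Vec; []; _∷_; zipWith; replicate)
  import Data.Vec.Properties as Vec
  open import Data.List as List using (List; _++_)
  open import Data.List.Relation.Unary.All as All using (All)
  import Data.List.Relation.Unary.All.Properties as All
  open import Data.Vec.Relation.Unary.All using ([]; _∷_) renaming (All to All′)
  open import Data.Bool using (true; false)
  open import Data.Product using (∃; _×_; _,_; proj₁; proj₂)
  open import Function using (_∘′_; _∘_)
  open import Function.Bundles using (_⇔_; mk⇔; Equivalence)
  open Equivalence using (to)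
  open import Relation.Nullary using (yes; no)
  open import Relation.Binary.PropositionalEquality

  -- The inequality description of t·P: the first of k + 2 coordinates lies between
  -- t·(k + 1) and the current top value M, and the remaining ones satisfy the same
  -- description with top value M + t·(k + 1) − z.
  Feasible : ∀ k → ℚ → ℚ → Vec ℚ (suc k) → Set
  Feasible zero    t M (z ∷ [])  = z ≡ M
  Feasible (suc k) t M (z ∷ zs) =
    t * ℕ→ℚ (suc k) ≤ z × z ≤ M × Feasible k t (M + t * ℕ→ℚ (suc k) - z) zs

  feasible-resp : ∀ k {t t′ M M′} z → t ≡ t′ → M ≡ M′ → Feasible k t M z → Feasible k t′ M′ z
  feasible-resp k z refl refl feasible = feasible

  gen-feasible : ∀ k top e → ℕ→ℚ k ≤ top → Feasible k 1ℚ top (gen ℕ→ℚ k top e)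
  gen-feasible zero    top []          _         = refl
  gen-feasible (suc k) top (true ∷ e)  k+1≤top =
    subst (_≤ top) (sym (ℚ.*-identityˡ _)) k+1≤top , ℚ.≤-refl ,
    feasible-resp k _ refl (solve 2 (λ K top → K := top :+ con 1ℚ :* K :- top) refl (ℕ→ℚ (suc k)) top)
      (gen-feasible k (ℕ→ℚ (suc k)) e (ℕ→ℚ-mono-≤ (ℕ.n≤1+n k)))
  gen-feasible (suc k) top (false ∷ e) k+1≤top =
    ℚ.≤-reflexive (ℚ.*-identityˡ _) , k+1≤top ,
    feasible-resp k _ refl (solve 2 (λ K top → top := top :+ con 1ℚ :* K :- K) refl (ℕ→ℚ (suc k)) top)
      (gen-feasible k top e (ℚ.≤-trans (ℕ→ℚ-mono-≤ (ℕ.n≤1+n k)) k+1≤top))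

  feasible-+ : ∀ k {t s M N} z z′ → Feasible k t M z → Feasible k s N z′ →
    Feasible k (t + s) (M + N) (zipWith _+_ z z′)
  feasible-+ zero    (z ∷ [])  (z′ ∷ [])   z≡M z′≡N = cong₂ _+_ z≡M z′≡N
  feasible-+ (suc k) {t} {s} {M} {N} (z ∷ zs) (z′ ∷ zs′)
             (lo≤z , z≤M , feasible) (lo≤z′ , z′≤N , feasible′) =
    subst (_≤ z + z′) (sym (ℚ.*-distribʳ-+ K t s)) (ℚ.+-mono-≤ lo≤z lo≤z′) , ℚ.+-mono-≤ z≤M z′≤N ,
    feasible-resp k _ refl
      (solve 7 (λ t s M N z z′ K → (M :+ t :* K :- z) :+ (N :+ s :* K :- z′)
                                := (M :+ N) :+ (t :+ s) :* K :- (z :+ z′)) refl t s M N z z′ K)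
      (feasible-+ k zs zs′ feasible feasible′)
    where K = ℕ→ℚ (suc k)

  feasible-* : ∀ k {t M} z w → 0ℚ ≤ w → Feasible k t M z → Feasible k (w * t) (w * M) (Vec.map (w *_) z)
  feasible-* zero    (z ∷ [])  w 0≤w z≡M = cong (w *_) z≡M
  feasible-* (suc k) {t} {M} (z ∷ zs) w 0≤w (lo≤z , z≤M , feasible) =
    subst (_≤ w * z) (sym (ℚ.*-assoc w t K)) (ℚ.*-monoˡ-≤-nonNeg w {{ℚ.nonNegative 0≤w}} lo≤z) ,
    ℚ.*-monoˡ-≤-nonNeg w {{ℚ.nonNegative 0≤w}} z≤M ,
    feasible-resp k _ refl
      (solve 5 (λ w t M z K → w :* (M :+ t :* K :- z) := w :* M :+ w :* t :* K :- w :* z) refl w t M z K)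
      (feasible-* k zs w 0≤w feasible)
    where K = ℕ→ℚ (suc k)

  feasible-zero : ∀ k → Feasible k 0ℚ 0ℚ (replicate (suc k) 0ℚ)
  feasible-zero zero    = refl
  feasible-zero (suc k) = ℚ.≤-reflexive (ℚ.*-zeroˡ K) , ℚ.≤-refl ,
    feasible-resp k _ refl (solve 1 (λ K → con 0ℚ := con 0ℚ :+ con 0ℚ :* K :- con 0ℚ) refl K) (feasible-zero k)
    where K = ℕ→ℚ (suc k)

  weightedSum-feasible : ∀ d m (ws : List (Vec ℕ (suc d) × ℚ)) →
    All (IsGen ∘′ proj₁) ws → All ((0ℚ ≤_) ∘′ proj₂) ws →
    Feasible d (weightTotal ws * ℕ→ℚ m) (weightTotal ws * (ℕ→ℚ m * ℕ→ℚ (suc d))) (weightedSum m ws)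
  weightedSum-feasible d m List.[] All.[] All.[] =
    feasible-resp d _ (sym (ℚ.*-zeroˡ (ℕ→ℚ m))) (sym (ℚ.*-zeroˡ (ℕ→ℚ m * ℕ→ℚ (suc d)))) (feasible-zero d)
  weightedSum-feasible d m ((a , w) List.∷ ws) (isGen All.∷ isGens) (0≤w All.∷ 0≤ws)
    with e , refl ← toPerm-surjective d a isGen =
    feasible-resp d _
      (solve 3 (λ w T mq → w :* (mq :* con 1ℚ) :+ T :* mq := (w :+ T) :* mq) refl w T mq)
      (solve 4 (λ w T mq nq → w :* (mq :* nq) :+ T :* (mq :* nq) := (w :+ T) :* (mq :* nq)) refl w T mq nq)
      (feasible-+ d _ _ scaledGenerator (weightedSum-feasible d m ws isGens 0≤ws))
    where
    T = weightTotal ws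
    mq = ℕ→ℚ m
    nq = ℕ→ℚ (suc d)
    generator : Feasible d 1ℚ nq (toℚv (toPerm d e))
    generator = subst (Feasible d 1ℚ nq) (sym (map-gen ℕ→ℚ (λ i → i) d (suc d) e))
      (gen-feasible d nq e (ℕ→ℚ-mono-≤ (ℕ.n≤1+n d)))
    scaledGenerator : Feasible d (w * (mq * 1ℚ)) (w * (mq * nq)) (Vec.map (λ t → w * (mq * t)) (toℚv (toPerm d e)))
    scaledGenerator = subst (Feasible d _ _) (sym (Vec.map-∘ (w *_) (mq *_) (toℚv (toPerm d e))))
      (feasible-* d _ w 0≤w (feasible-* d _ mq (ℕ→ℚ-nonNeg m) generator))

  inDilate⇒feasible : ∀ d m (x : Vec ℤ (suc d)) → InDilate m x →
    Feasible d (ℕ→ℚ m) (ℕ→ℚ m * ℕ→ℚ (suc d)) (Vec.map ℤ→ℚ x)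
  inDilate⇒feasible d m x (ws , isGens , 0≤ws , total≡1 , sum≡x) =
    subst (Feasible d _ _) sum≡x (feasible-resp d _
      (trans (cong (_* ℕ→ℚ m) total≡1) (ℚ.*-identityˡ _))
      (trans (cong (_* (ℕ→ℚ m * ℕ→ℚ (suc d))) total≡1) (ℚ.*-identityˡ _))
      (weightedSum-feasible d m ws isGens 0≤ws))

  mix : ℚ → ℚ → ℚ → ℚ
  mix ρ a b = ρ * a + (1ℚ - ρ) * b

  Probability : ℚ → Set
  Probability ρ = 0ℚ ≤ ρ × ρ ≤ 1ℚ

  interpolate : ∀ {lo z M} → lo ≤ z → z ≤ M → ∃ λ ρ → Probability ρ × mix ρ M lo ≡ z
  interpolate {lo} {z} {M} lo≤z z≤M with M ℚ.≟ lo
  ... | yes refl = 0ℚ , (ℚ.≤-refl , ℚ.<⇒≤ (ℚ.positive⁻¹ 1ℚ)) ,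
    trans (solve 1 (λ lo → con 0ℚ :* lo :+ (con 1ℚ :- con 0ℚ) :* lo := lo) refl lo) (ℚ.≤-antisym lo≤z z≤M)
  ... | no M≢lo = ρ , (0≤ρ , ρ≤1) , mixed
    where
    D = M - lo
    instance
      D-pos : ℚ.Positive D
      D-pos = ℚ.positive (<⇒0<- (ℚ.≰⇒> (λ M≤lo → M≢lo (ℚ.≤-antisym M≤lo (ℚ.≤-trans lo≤z z≤M)))))
      D-nonZero : ℚ.NonZero D
      D-nonZero = ℚ.pos⇒nonZero D
    ρ = (z - lo) * 1/ D
    ρD≡z-lo : ρ * D ≡ z - lo
    ρD≡z-lo = trans (ℚ.*-assoc (z - lo) (1/ D) D) (trans (cong ((z - lo) *_) (ℚ.*-inverseˡ D)) (ℚ.*-identityʳ _))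
    0≤ρ : 0ℚ ≤ ρ
    0≤ρ = ℚ.nonNegative⁻¹ ρ {{ℚ.nonNeg*nonNeg⇒nonNeg (z - lo) {{ℚ.nonNegative (to p≤q⇔0≤q-p lo≤z)}} (1/ D)
            {{ℚ.pos⇒nonNeg (1/ D) {{ℚ.1/pos⇒pos D}}}}}}
    ρ≤1 : ρ ≤ 1ℚ
    ρ≤1 = ℚ.*-cancelʳ-≤-pos D (subst₂ _≤_ (sym ρD≡z-lo) (sym (ℚ.*-identityˡ D)) (ℚ.+-monoˡ-≤ (- lo) z≤M))
    mixed : mix ρ M lo ≡ z
    mixed = begin
      ρ * M + (1ℚ - ρ) * lo
        ≡⟨ solve 3 (λ ρ M lo → ρ :* M :+ (con 1ℚ :- ρ) :* lo := lo :+ ρ :* (M :- lo)) refl ρ M lo ⟩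
      lo + ρ * D              ≡⟨ cong (lo +_) ρD≡z-lo ⟩
      lo + (z - lo)           ≡⟨ solve 2 (λ lo z → lo :+ (z :- lo) := z) refl lo z ⟩
      z                       ∎
      where open ≡-Reasoning

  mix-swap : ∀ ρ a b → mix ρ b a ≡ a + b - mix ρ a b
  mix-swap = solve 3 (λ ρ a b → ρ :* b :+ (con 1ℚ :- ρ) :* a := a :+ b :- (ρ :* a :+ (con 1ℚ :- ρ) :* b)) refl

  -- expectedPoint k t M ρs is the mean of gen (λ j → t * ℕ→ℚ j) k M e when each bit of e
  -- is independently true, the i-th with probability ρ_i.
  expectedPoint : ∀ k → ℚ → ℚ → Vec ℚ k → Vec ℚ (suc k)
  expectedPoint zero    t M []       = M ∷ []
  expectedPoint (suc k) t M (ρ ∷ ρs) =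
    mix ρ M (t * ℕ→ℚ (suc k)) ∷
    zipWith (mix ρ) (expectedPoint k t (t * ℕ→ℚ (suc k)) ρs) (expectedPoint k t M ρs)

  zipWith-mix-shared : ∀ {n} ρ σ (u a b : Vec ℚ n) →
    zipWith (mix ρ) (zipWith (mix σ) u a) (zipWith (mix σ) u b) ≡ zipWith (mix σ) u (zipWith (mix ρ) a b)
  zipWith-mix-shared ρ σ []       []       []       = refl
  zipWith-mix-shared ρ σ (u ∷ us) (a ∷ as) (b ∷ bs) = cong₂ _∷_
    (solve 5 (λ ρ σ u a b → ρ :* (σ :* u :+ (con 1ℚ :- σ) :* a)
                           :+ (con 1ℚ :- ρ) :* (σ :* u :+ (con 1ℚ :- σ) :* b)
                         := σ :* u :+ (con 1ℚ :- σ) :* (ρ :* a :+ (con 1ℚ :- ρ) :* b)) refl ρ σ u a b)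
    (zipWith-mix-shared ρ σ us as bs)

  expectedPoint-mix : ∀ k t A B ρ ρs →
    zipWith (mix ρ) (expectedPoint k t A ρs) (expectedPoint k t B ρs) ≡ expectedPoint k t (mix ρ A B) ρs
  expectedPoint-mix zero    t A B ρ []       = refl
  expectedPoint-mix (suc k) t A B ρ (σ ∷ ρs) = cong₂ _∷_
    (solve 5 (λ ρ σ A B lo → ρ :* (σ :* A :+ (con 1ℚ :- σ) :* lo)
                             :+ (con 1ℚ :- ρ) :* (σ :* B :+ (con 1ℚ :- σ) :* lo)
                           := σ :* (ρ :* A :+ (con 1ℚ :- ρ) :* B) :+ (con 1ℚ :- σ) :* lo) refl ρ σ A B lo)
    (trans (zipWith-mix-shared ρ σ (expectedPoint k t lo ρs) (expectedPoint k t A ρs) (expectedPoint k t B ρs))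
           (cong (zipWith (mix σ) (expectedPoint k t lo ρs)) (expectedPoint-mix k t A B ρ ρs)))
    where lo = t * ℕ→ℚ (suc k)

  feasible⇒expectedPoint : ∀ k t M z → Feasible k t M z →
    ∃ λ ρs → All′ Probability ρs × expectedPoint k t M ρs ≡ z
  feasible⇒expectedPoint zero    t M (z ∷ [])  z≡M = [] , [] , cong (_∷ []) (sym z≡M)
  feasible⇒expectedPoint (suc k) t M (z ∷ zs) (lo≤z , z≤M , feasible)
    with ρ , probability , mixed ← interpolate lo≤z z≤M
       | ρs , probabilities , expected ← feasible⇒expectedPoint k t _ zs feasible
    = ρ ∷ ρs , probability ∷ probabilities , cong₂ _∷_ mixed (begin
        zipWith (mix ρ) (expectedPoint k t lo ρs) (expectedPoint k t M ρs) ≡⟨ expectedPoint-mix k t lo M ρ ρs ⟩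
        expectedPoint k t (mix ρ lo M) ρs        ≡⟨ cong (λ M′ → expectedPoint k t M′ ρs) top≡ ⟩
        expectedPoint k t (M + lo - z) ρs        ≡⟨ expected ⟩
        zs                                       ∎)
    where
    open ≡-Reasoning
    lo = t * ℕ→ℚ (suc k)
    top≡ : mix ρ lo M ≡ M + lo - z
    top≡ = trans (mix-swap ρ M lo) (cong (λ x → M + lo - x) mixed)

  prepend : ∀ {k} → ℕ → ℚ → Vec ℕ k × ℚ → Vec ℕ (suc k) × ℚ
  prepend x s (a , w) = x ∷ a , s * w

  weightedWords : ∀ k → ℕ → Vec ℚ k → List (Vec ℕ (suc k) × ℚ)
  weightedWords zero    M []       = List.[ M ∷ [] , 1ℚ ]
  weightedWords (suc k) M (ρ ∷ ρs) = List.map (prepend M ρ) (weightedWords k (suc k) ρs)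
                                  ++ List.map (prepend (suc k) (1ℚ - ρ)) (weightedWords k M ρs)

  weightedWords-words : ∀ k M ρs → All (λ p → ∃ λ e → proj₁ p ≡ word k M e) (weightedWords k M ρs)
  weightedWords-words zero    M []       = ([] , refl) All.∷ All.[]
  weightedWords-words (suc k) M (ρ ∷ ρs) = All.++⁺
    (All.map⁺ (All.map (λ (e , eq) → true ∷ e , cong (M ∷_) eq) (weightedWords-words k (suc k) ρs)))
    (All.map⁺ (All.map (λ (e , eq) → false ∷ e , cong (suc k ∷_) eq) (weightedWords-words k M ρs)))

  weightedWords-nonNeg : ∀ k M ρs → All′ Probability ρs → All ((0ℚ ≤_) ∘′ proj₂) (weightedWords k M ρs)
  weightedWords-nonNeg zero    M []       []                      = ℚ.<⇒≤ (ℚ.positive⁻¹ 1ℚ) All.∷ All.[]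
  weightedWords-nonNeg (suc k) M (ρ ∷ ρs) ((0≤ρ , ρ≤1) ∷ probabilities) = All.++⁺
    (All.map⁺ (All.map (nonNeg-* 0≤ρ) (weightedWords-nonNeg k (suc k) ρs probabilities)))
    (All.map⁺ (All.map (nonNeg-* (to p≤q⇔0≤q-p ρ≤1)) (weightedWords-nonNeg k M ρs probabilities)))
    where
    nonNeg-* : ∀ {s w} → 0ℚ ≤ s → 0ℚ ≤ w → 0ℚ ≤ s * w
    nonNeg-* {s} {w} 0≤s 0≤w = ℚ.nonNegative⁻¹ (s * w)
      {{ℚ.nonNeg*nonNeg⇒nonNeg s {{ℚ.nonNegative 0≤s}} w {{ℚ.nonNegative 0≤w}}}}

  weightTotal-++ : ∀ {n} (xs ys : List (Vec ℕ n × ℚ)) → weightTotal (xs ++ ys) ≡ weightTotal xs + weightTotal ys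
  weightTotal-++ List.[]              ys = sym (ℚ.+-identityˡ _)
  weightTotal-++ ((a , w) List.∷ xs) ys = trans (cong (w +_) (weightTotal-++ xs ys)) (sym (ℚ.+-assoc w _ _))

  weightTotal-prepend : ∀ {n} x s (xs : List (Vec ℕ n × ℚ)) →
    weightTotal (List.map (prepend x s) xs) ≡ s * weightTotal xs
  weightTotal-prepend x s List.[]              = sym (ℚ.*-zeroʳ s)
  weightTotal-prepend x s ((a , w) List.∷ xs) =
    trans (cong (s * w +_) (weightTotal-prepend x s xs)) (sym (ℚ.*-distribˡ-+ s w _))

  weightTotal-weightedWords : ∀ k M ρs → weightTotal (weightedWords k M ρs) ≡ 1ℚ
  weightTotal-weightedWords zero    M []       = ℚ.+-identityʳ 1ℚ
  weightTotal-weightedWords (suc k) M (ρ ∷ ρs) = begin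
    weightTotal (List.map (prepend M ρ) xs ++ List.map (prepend (suc k) (1ℚ - ρ)) ys)
      ≡⟨ weightTotal-++ (List.map (prepend M ρ) xs) _ ⟩
    weightTotal (List.map (prepend M ρ) xs) + weightTotal (List.map (prepend (suc k) (1ℚ - ρ)) ys)
      ≡⟨ cong₂ _+_ (weightTotal-prepend M ρ xs) (weightTotal-prepend (suc k) (1ℚ - ρ) ys) ⟩
    ρ * weightTotal xs + (1ℚ - ρ) * weightTotal ys
      ≡⟨ cong₂ (λ X Y → ρ * X + (1ℚ - ρ) * Y)
               (weightTotal-weightedWords k (suc k) ρs) (weightTotal-weightedWords k M ρs) ⟩
    ρ * 1ℚ + (1ℚ - ρ) * 1ℚ
      ≡⟨ solve 1 (λ ρ → ρ :* con 1ℚ :+ (con 1ℚ :- ρ) :* con 1ℚ := con 1ℚ) refl ρ ⟩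
    1ℚ ∎
    where
    open ≡-Reasoning
    xs = weightedWords k (suc k) ρs
    ys = weightedWords k M ρs

  zipWith-+-identityˡ : ∀ {n} (v : Vec ℚ n) → zipWith _+_ (replicate n 0ℚ) v ≡ v
  zipWith-+-identityˡ []       = refl
  zipWith-+-identityˡ (x ∷ v) = cong₂ _∷_ (ℚ.+-identityˡ x) (zipWith-+-identityˡ v)

  zipWith-+-assoc : ∀ {n} (a b c : Vec ℚ n) → zipWith _+_ a (zipWith _+_ b c) ≡ zipWith _+_ (zipWith _+_ a b) c
  zipWith-+-assoc []       []       []       = refl
  zipWith-+-assoc (a ∷ as) (b ∷ bs) (c ∷ cs) = cong₂ _∷_ (sym (ℚ.+-assoc a b c)) (zipWith-+-assoc as bs cs)

  weightedSum-++ : ∀ {n} m (xs ys : List (Vec ℕ n × ℚ)) →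
    weightedSum m (xs ++ ys) ≡ zipWith _+_ (weightedSum m xs) (weightedSum m ys)
  weightedSum-++ m List.[]              ys = sym (zipWith-+-identityˡ _)
  weightedSum-++ m ((a , w) List.∷ xs) ys = trans (cong (zipWith _+_ _) (weightedSum-++ m xs ys)) (zipWith-+-assoc _ _ _)

  map-*-replicate : ∀ {n} s → Vec.map (s *_) (replicate n 0ℚ) ≡ replicate n 0ℚ
  map-*-replicate {zero}  s = refl
  map-*-replicate {suc n} s = cong₂ _∷_ (ℚ.*-zeroʳ s) (map-*-replicate s)

  weightedSum-prepend : ∀ {n} m x s (xs : List (Vec ℕ n × ℚ)) →
    weightedSum m (List.map (prepend x s) xs)
      ≡ (s * weightTotal xs * (ℕ→ℚ m * ℕ→ℚ x)) ∷ Vec.map (s *_) (weightedSum m xs)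
  weightedSum-prepend m x s List.[]              =
    cong₂ _∷_ (solve 2 (λ s y → con 0ℚ := s :* con 0ℚ :* y) refl s (ℕ→ℚ m * ℕ→ℚ x)) (sym (map-*-replicate s))
  weightedSum-prepend m x s ((a , w) List.∷ xs) rewrite weightedSum-prepend m x s xs = cong₂ _∷_
    (solve 4 (λ s w T y → s :* w :* y :+ s :* T :* y := s :* (w :+ T) :* y)
       refl s w (weightTotal xs) (ℕ→ℚ m * ℕ→ℚ x))
    (distrib (toℚv a) (weightedSum m xs))
    where
    distrib : ∀ {n} (u v : Vec ℚ n) → zipWith _+_ (Vec.map (λ t → s * w * (ℕ→ℚ m * t)) u) (Vec.map (s *_) v)
                                    ≡ Vec.map (s *_) (zipWith _+_ (Vec.map (λ t → w * (ℕ→ℚ m * t)) u) v)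
    distrib []       []       = refl
    distrib (u ∷ us) (v ∷ vs) = cong₂ _∷_
      (solve 5 (λ s w mq u v → s :* w :* (mq :* u) :+ s :* v := s :* (w :* (mq :* u) :+ v)) refl s w (ℕ→ℚ m) u v)
      (distrib us vs)

  zipWith-+-scaled : ∀ {n} ρ (a b : Vec ℚ n) →
    zipWith _+_ (Vec.map (ρ *_) a) (Vec.map ((1ℚ - ρ) *_) b) ≡ zipWith (mix ρ) a b
  zipWith-+-scaled ρ []       []       = refl
  zipWith-+-scaled ρ (a ∷ as) (b ∷ bs) = cong (mix ρ a b ∷_) (zipWith-+-scaled ρ as bs)

  weightedSum-weightedWords : ∀ m k M ρs →
    weightedSum m (weightedWords k M ρs) ≡ expectedPoint k (ℕ→ℚ m) (ℕ→ℚ m * ℕ→ℚ M) ρs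
  weightedSum-weightedWords m zero    M []       = cong (_∷ []) (trans (ℚ.+-identityʳ _) (ℚ.*-identityˡ _))
  weightedSum-weightedWords m (suc k) M (ρ ∷ ρs) = begin
    weightedSum m (List.map (prepend M ρ) xs ++ List.map (prepend (suc k) (1ℚ - ρ)) ys)
      ≡⟨ weightedSum-++ m (List.map (prepend M ρ) xs) _ ⟩
    zipWith _+_ (weightedSum m (List.map (prepend M ρ) xs)) (weightedSum m (List.map (prepend (suc k) (1ℚ - ρ)) ys))
      ≡⟨ cong₂ (zipWith _+_) (weightedSum-prepend m M ρ xs) (weightedSum-prepend m (suc k) (1ℚ - ρ) ys) ⟩
    (ρ * weightTotal xs * (mq * ℕ→ℚ M) + (1ℚ - ρ) * weightTotal ys * (mq * ℕ→ℚ (suc k))) ∷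
      zipWith _+_ (Vec.map (ρ *_) (weightedSum m xs)) (Vec.map ((1ℚ - ρ) *_) (weightedSum m ys))
      ≡⟨ cong₂ _∷_ head (zipWith-+-scaled ρ (weightedSum m xs) (weightedSum m ys)) ⟩
    mix ρ (mq * ℕ→ℚ M) (mq * ℕ→ℚ (suc k)) ∷ zipWith (mix ρ) (weightedSum m xs) (weightedSum m ys)
      ≡⟨ cong₂ (λ X Y → mix ρ (mq * ℕ→ℚ M) (mq * ℕ→ℚ (suc k)) ∷ zipWith (mix ρ) X Y)
               (weightedSum-weightedWords m k (suc k) ρs) (weightedSum-weightedWords m k M ρs) ⟩
    expectedPoint (suc k) mq (mq * ℕ→ℚ M) (ρ ∷ ρs) ∎
    where
    open ≡-Reasoning
    mq = ℕ→ℚ m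
    xs = weightedWords k (suc k) ρs
    ys = weightedWords k M ρs
    head : ρ * weightTotal xs * (mq * ℕ→ℚ M) + (1ℚ - ρ) * weightTotal ys * (mq * ℕ→ℚ (suc k))
         ≡ mix ρ (mq * ℕ→ℚ M) (mq * ℕ→ℚ (suc k))
    head rewrite weightTotal-weightedWords k (suc k) ρs | weightTotal-weightedWords k M ρs =
      solve 3 (λ ρ A B → ρ :* con 1ℚ :* A :+ (con 1ℚ :- ρ) :* con 1ℚ :* B := ρ :* A :+ (con 1ℚ :- ρ) :* B)
        refl ρ _ _

  feasible⇒inDilate : ∀ d m (x : Vec ℤ (suc d)) →
    Feasible d (ℕ→ℚ m) (ℕ→ℚ m * ℕ→ℚ (suc d)) (Vec.map ℤ→ℚ x) → InDilate m x
  feasible⇒inDilate d m x feasible with ρs , probabilities , expected ← feasible⇒expectedPoint d _ _ _ feasible =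
    weightedWords d (suc d) ρs ,
    All.map (λ (e , eq) → subst IsGen (sym eq) (toPerm-isGen d e)) (weightedWords-words d (suc d) ρs) ,
    weightedWords-nonNeg d (suc d) ρs probabilities ,
    weightTotal-weightedWords d (suc d) ρs ,
    trans (weightedSum-weightedWords m d (suc d) ρs) expected

  inDilate⇔feasible : ∀ d m (x : Vec ℤ (suc d)) →
    InDilate m x ⇔ Feasible d (ℕ→ℚ m) (ℕ→ℚ (m ℕ.* suc d)) (Vec.map ℤ→ℚ x)
  inDilate⇔feasible d m x = mk⇔
    (subst (λ T → Feasible d (ℕ→ℚ m) T (Vec.map ℤ→ℚ x)) (sym (ℕ→ℚ-* m (suc d))) ∘ inDilate⇒feasible d m x)
    (feasible⇒inDilate d m x ∘ subst (λ T → Feasible d (ℕ→ℚ m) T (Vec.map ℤ→ℚ x)) (ℕ→ℚ-* m (suc d)))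

module RisingFactorial where

  open import Defs using (ehrProd)
  open import Data.Nat using (ℕ; zero; suc; _+_; _*_)
  import Data.Nat.Properties as ℕ
  open import Data.Nat.Solver using (module +-*-Solver)
  open +-*-Solver
  open import Data.Nat.ListAction using (product)
  open import Data.List as List using (applyUpTo)
  import Data.List.Properties as List
  open import Function using (_∘′_)
  open import Relation.Binary.PropositionalEquality

  rising : ℕ → ℕ → ℕ
  rising a zero    = 1
  rising a (suc k) = a * rising (suc a) k

  rising-snoc : ∀ a k → rising a (suc k) ≡ rising a k * (a + k)
  rising-snoc a zero    = solve 1 (λ a → a :* con 1 := con 1 :* (a :+ con 0)) refl a
  rising-snoc a (suc k) = begin
    a * rising (suc a) (suc k)        ≡⟨ cong (a *_) (rising-snoc (suc a) k) ⟩
    a * (rising (suc a) k * (suc a + k)) ≡⟨ cong (λ t → a * (rising (suc a) k * t)) (sym (ℕ.+-suc a k)) ⟩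
    a * (rising (suc a) k * (a + suc k)) ≡⟨ sym (ℕ.*-assoc a _ _) ⟩
    a * rising (suc a) k * (a + suc k)   ∎
    where open ≡-Reasoning

  product-applyUpTo : ∀ a k (f : ℕ → ℕ) → (∀ i → f i ≡ a + i) → product (applyUpTo f k) ≡ rising a k
  product-applyUpTo a zero    f f≗a+ = refl
  product-applyUpTo a (suc k) f f≗a+ = cong₂ _*_ (trans (f≗a+ 0) (ℕ.+-identityʳ a))
    (product-applyUpTo (suc a) k (f ∘′ suc) (λ i → trans (f≗a+ (suc i)) (ℕ.+-suc a i)))

  ehrProd≡rising : ∀ k m → ehrProd (2 + k) m ≡ rising ((2 + k) * m + 2) k
  ehrProd≡rising k m = trans (cong product (List.map-applyUpTo _ (λ j → (2 + k) * m + j) k))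
    (product-applyUpTo ((2 + k) * m + 2) k _ (λ i → sym (ℕ.+-assoc ((2 + k) * m) 2 i)))

module LatticePoints where

  open import Defs using (ℕ→ℚ; ℤ→ℚ)
  open Rationals
  open Dilates using (Feasible)
  open import Data.Nat as ℕ using (ℕ; zero; suc; _+_; _*_; _∸_; _≤_; _<_; z≤n; s≤s; _!)
  open import Data.Nat.Solver using () renaming (module +-*-Solver to ℕ-Solver)
  open RisingFactorial using (rising; rising-snoc)
  import Data.Nat.Properties as ℕ
  open import Data.Integer as ℤ using (ℤ; -[1+_])
  import Data.Integer.Properties as ℤ
  open import Data.Rational as ℚ using (ℚ; 0ℚ)
  import Data.Rational.Properties as ℚ
  open import Data.Rational.Solver using (module +-*-Solver)
  open import Data.Vec as Vec using (Vec; []; _∷_)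
  import Data.Vec.Properties as Vec
  open import Data.List as List using (List; concat; applyUpTo; length; _++_)
  import Data.List.Properties as List
  open import Data.List.Membership.Propositional using (_∈_)
  open import Data.List.Membership.Propositional.Properties
    using (∈-map⁺; ∈-map⁻; ∈-concat⁺′; ∈-concat⁻′; ∈-applyUpTo⁺; ∈-applyUpTo⁻)
  open import Data.List.Relation.Unary.Any using (here)
  open import Data.List.Relation.Unary.All using ([]; _∷_)
  import Data.List.Relation.Unary.All.Properties as All
  open import Data.List.Relation.Unary.AllPairs using (AllPairs; []; _∷_)
  open import Data.List.Relation.Unary.Unique.Propositional using (Unique)
  import Data.List.Relation.Unary.Unique.Propositional.Properties as Unique
  open import Data.List.Relation.Binary.Disjoint.Propositional using (Disjoint)
  open import Data.Nat.ListAction using (sum)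
  open import Data.Product using (∃; _×_; _,_)
  open import Data.Empty using (⊥-elim)
  open import Function using (_∘_)
  open import Function.Bundles using (_⇔_; mk⇔)
  open import Relation.Binary.PropositionalEquality

  applyUpTo-cong : ∀ {A : Set} {f g : ℕ → A} n → (∀ i → f i ≡ g i) → applyUpTo f n ≡ applyUpTo g n
  applyUpTo-cong zero    f≗g = refl
  applyUpTo-cong (suc n) f≗g = cong₂ List._∷_ (f≗g 0) (applyUpTo-cong n (f≗g ∘ suc))

  allPairs-applyUpTo : ∀ {A : Set} {R : A → A → Set} (f : ℕ → A) n →
    (∀ {i j} → i < j → R (f i) (f j)) → AllPairs R (applyUpTo f n)
  allPairs-applyUpTo f zero    Rf = []
  allPairs-applyUpTo f (suc n) Rf =
    All.applyUpTo⁺₂ (f ∘ suc) n (λ _ → Rf (s≤s z≤n)) ∷ allPairs-applyUpTo (f ∘ suc) n (Rf ∘ s≤s)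

  length-concat : ∀ {A : Set} (xss : List (List A)) → length (concat xss) ≡ sum (List.map length xss)
  length-concat List.[]           = refl
  length-concat (xs List.∷ xss) = trans (List.length-++ xs) (cong (length xs +_) (length-concat xss))

  +≤⇒<suc∸ : ∀ lo M j → lo + j ≤ M → j < suc M ∸ lo
  +≤⇒<suc∸ zero     M       j lo+j≤M       = s≤s lo+j≤M
  +≤⇒<suc∸ (suc lo) (suc M) j (s≤s lo+j≤M) = +≤⇒<suc∸ lo M j lo+j≤M

  <suc∸⇒+≤ : ∀ lo M j → j < suc M ∸ lo → lo + j ≤ M
  <suc∸⇒+≤ zero     M       j j<         = ℕ.s≤s⁻¹ j<
  <suc∸⇒+≤ (suc lo) zero    j j<         = ⊥-elim (ℕ.n≮0 (subst (j <_) (ℕ.0∸n≡0 lo) j<))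
  <suc∸⇒+≤ (suc lo) (suc M) j j<         = s≤s (<suc∸⇒+≤ lo M j j<)

  ℤ→ℚ-nonNeg : ∀ z → 0ℚ ℚ.≤ ℤ→ℚ z → ∃ λ a → z ≡ ℤ.+ a
  ℤ→ℚ-nonNeg (ℤ.+ a)  _   = a , refl
  ℤ→ℚ-nonNeg -[1+ a ] 0≤z = ⊥-elim (ℚ.<-irrefl refl (ℚ.≤-<-trans 0≤z
    (ℚ.negative⁻¹ _ {{ℚ.neg-pos {ℚ.normalize (suc a) 1} (ℚ.normalize-pos (suc a) 1)}})))

  ℕ→ℚ-nextTop : ∀ lo j M → lo + j ≤ M →
    ℕ→ℚ M ℚ.+ ℕ→ℚ lo ℚ.- ℕ→ℚ (lo + j) ≡ ℕ→ℚ (M ∸ j)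
  ℕ→ℚ-nextTop lo j M lo+j≤M = begin
    ℕ→ℚ M ℚ.+ ℕ→ℚ lo ℚ.- ℕ→ℚ (lo + j)
      ≡⟨ cong₂ (λ X Y → X ℚ.+ ℕ→ℚ lo ℚ.- Y) (trans (cong ℕ→ℚ (sym (ℕ.m∸n+n≡m j≤M))) (ℕ→ℚ-+ (M ∸ j) j))
                 (ℕ→ℚ-+ lo j) ⟩
    (ℕ→ℚ (M ∸ j) ℚ.+ ℕ→ℚ j) ℚ.+ ℕ→ℚ lo ℚ.- (ℕ→ℚ lo ℚ.+ ℕ→ℚ j)
      ≡⟨ solve 3 (λ D J L → (D :+ J) :+ L :- (L :+ J) := D) refl (ℕ→ℚ (M ∸ j)) (ℕ→ℚ j) (ℕ→ℚ lo) ⟩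
    ℕ→ℚ (M ∸ j) ∎
    where
    open ≡-Reasoning
    open +-*-Solver
    j≤M = ℕ.m+n≤o⇒n≤o lo lo+j≤M

  Vec-map-injective : ∀ {A B : Set} {f : A → B} → (∀ {x y} → f x ≡ f y → x ≡ y) →
    ∀ {n} {u v : Vec A n} → Vec.map f u ≡ Vec.map f v → u ≡ v
  Vec-map-injective f-inj {u = []}    {[]}    _  = refl
  Vec-map-injective f-inj {u = x ∷ u} {y ∷ v} eq =
    cong₂ _∷_ (f-inj (Vec.∷-injectiveˡ eq)) (Vec-map-injective f-inj (Vec.∷-injectiveʳ eq))

  module _ (m : ℕ) where

    latticePoints : ∀ k → ℕ → List (Vec ℕ (suc k))
    slice : ∀ k → ℕ → ℕ → List (Vec ℕ (suc (suc k)))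

    latticePoints zero    M = List.[ M ∷ [] ]
    latticePoints (suc k) M = concat (applyUpTo (slice k M) (suc M ∸ m * suc k))

    slice k M j = List.map ((m * suc k + j) ∷_) (latticePoints k (M ∸ j))

    ∈-latticePoints⁻ : ∀ k M {v} → v ∈ latticePoints (suc k) M →
      ∃ λ j → j < suc M ∸ m * suc k × ∃ λ w → v ≡ (m * suc k + j) ∷ w × w ∈ latticePoints k (M ∸ j)
    ∈-latticePoints⁻ k M v∈ with xs , v∈xs , xs∈ ← ∈-concat⁻′ (applyUpTo (slice k M) (suc M ∸ m * suc k)) v∈
      with j , j< , refl ← ∈-applyUpTo⁻ (slice k M) xs∈
      with w , w∈ , refl ← ∈-map⁻ _ v∈xs = j , j< , w , refl , w∈

    ∈-latticePoints⁺ : ∀ k M {j w} → j < suc M ∸ m * suc k → w ∈ latticePoints k (M ∸ j) →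
      ((m * suc k + j) ∷ w) ∈ latticePoints (suc k) M
    ∈-latticePoints⁺ k M j< w∈ = ∈-concat⁺′ (∈-map⁺ _ w∈) (∈-applyUpTo⁺ (slice k M) j<)

    latticePoints-unique : ∀ k M → Unique (latticePoints k M)
    latticePoints-unique zero    M = [] ∷ []
    latticePoints-unique (suc k) M = Unique.concat⁺
      (All.applyUpTo⁺₂ (slice k M) (suc M ∸ m * suc k)
        (λ j → Unique.map⁺ Vec.∷-injectiveʳ (latticePoints-unique k (M ∸ j))))
      (allPairs-applyUpTo (slice k M) (suc M ∸ m * suc k) disjoint)
      where
      disjoint : ∀ {i j} → i < j → Disjoint (slice k M i) (slice k M j)
      disjoint i<j (v∈i , v∈j) with _ , _ , refl ← ∈-map⁻ _ v∈i | _ , _ , eq ← ∈-map⁻ _ v∈j =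
        ℕ.<⇒≢ i<j (ℕ.+-cancelˡ-≡ (m * suc k) _ _ (Vec.∷-injectiveˡ eq))

    private
      lo≡ : ∀ k → ℕ→ℚ m ℚ.* ℕ→ℚ (suc k) ≡ ℕ→ℚ (m * suc k)
      lo≡ k = sym (ℕ→ℚ-* m (suc k))

    firstCoordinate : ∀ k M z → ℕ→ℚ m ℚ.* ℕ→ℚ (suc k) ℚ.≤ ℤ→ℚ z → ℤ→ℚ z ℚ.≤ ℕ→ℚ M →
      ∃ λ j → z ≡ ℤ.+ (m * suc k + j) × m * suc k + j ≤ M
    firstCoordinate k M z lo≤z z≤M
      with a , refl ← ℤ→ℚ-nonNeg z (ℚ.≤-trans (subst (0ℚ ℚ.≤_) (sym (lo≡ k)) (ℕ→ℚ-nonNeg (m * suc k))) lo≤z)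
      with j , refl ← ℕ.m≤n⇒∃[o]m+o≡n {m * suc k} {a} (ℕ→ℚ-cancel-≤ (subst (ℚ._≤ ℕ→ℚ a) (lo≡ k) lo≤z))
      = j , refl , ℕ→ℚ-cancel-≤ z≤M

    feasible⇒∈latticePoints : ∀ k M (x : Vec ℤ (suc k)) → Feasible k (ℕ→ℚ m) (ℕ→ℚ M) (Vec.map ℤ→ℚ x) →
      ∃ λ v → v ∈ latticePoints k M × x ≡ Vec.map (ℤ.+_) v
    feasible⇒∈latticePoints zero M (z ∷ []) z≡M
      with a , refl ← ℤ→ℚ-nonNeg z (subst (0ℚ ℚ.≤_) (sym z≡M) (ℕ→ℚ-nonNeg M))
      = M ∷ [] , here refl , cong (λ b → ℤ.+ b ∷ []) (ℕ→ℚ-injective z≡M)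
    feasible⇒∈latticePoints (suc k) M (z ∷ zs) (lo≤z , z≤M , feasible) =
      let j , z≡ , lo+j≤M = firstCoordinate k M z lo≤z z≤M
          w , w∈ , zs≡ = feasible⇒∈latticePoints k (M ∸ j) zs
                           (subst (λ T → Feasible k (ℕ→ℚ m) T (Vec.map ℤ→ℚ zs)) (nextTop z≡ lo+j≤M) feasible)
      in (m * suc k + j) ∷ w , ∈-latticePoints⁺ k M (+≤⇒<suc∸ (m * suc k) M j lo+j≤M) w∈ , cong₂ _∷_ z≡ zs≡
      where
      nextTop : ∀ {j} → z ≡ ℤ.+ (m * suc k + j) → m * suc k + j ≤ M →
        ℕ→ℚ M ℚ.+ ℕ→ℚ m ℚ.* ℕ→ℚ (suc k) ℚ.- ℤ→ℚ z ≡ ℕ→ℚ (M ∸ j)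
      nextTop {j} z≡ lo+j≤M =
        trans (cong₂ (λ L Z → ℕ→ℚ M ℚ.+ L ℚ.- ℤ→ℚ Z) (lo≡ k) z≡) (ℕ→ℚ-nextTop (m * suc k) j M lo+j≤M)

    ∈latticePoints⇒feasible : ∀ k M v → v ∈ latticePoints k M →
      Feasible k (ℕ→ℚ m) (ℕ→ℚ M) (Vec.map ℤ→ℚ (Vec.map (ℤ.+_) v))
    ∈latticePoints⇒feasible zero    M (a ∷ []) (here refl) = refl
    ∈latticePoints⇒feasible (suc k) M v v∈ with j , j< , w , refl , w∈ ← ∈-latticePoints⁻ k M v∈ =
      subst (ℚ._≤ ℕ→ℚ (m * suc k + j)) (sym (lo≡ k)) (ℕ→ℚ-mono-≤ (ℕ.m≤m+n (m * suc k) j)) ,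
      ℕ→ℚ-mono-≤ lo+j≤M ,
      subst (λ T → Feasible k (ℕ→ℚ m) T (Vec.map ℤ→ℚ (Vec.map (ℤ.+_) w)))
        (sym (trans (cong (λ L → ℕ→ℚ M ℚ.+ L ℚ.- ℕ→ℚ (m * suc k + j)) (lo≡ k))
                    (ℕ→ℚ-nextTop (m * suc k) j M lo+j≤M)))
        (∈latticePoints⇒feasible k (M ∸ j) w w∈)
      where lo+j≤M = <suc∸⇒+≤ (m * suc k) M j j<

    count : ℕ → ℕ → ℕ
    count k M = length (latticePoints k M)

    private
      columnSum : ℕ → ℕ → ℕ → ℕ
      columnSum k M c = sum (applyUpTo (λ j → count k (M ∸ j)) c)

      count-columnSum : ∀ k u → count (suc k) (m * suc k + u) ≡ columnSum k (m * suc k + u) (suc u)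
      count-columnSum k u = begin
        length (concat (applyUpTo (slice k M) (suc M ∸ m * suc k)))
          ≡⟨ length-concat (applyUpTo (slice k M) (suc M ∸ m * suc k)) ⟩
        sum (List.map length (applyUpTo (slice k M) (suc M ∸ m * suc k)))
          ≡⟨ cong sum (List.map-applyUpTo (slice k M) length (suc M ∸ m * suc k)) ⟩
        sum (applyUpTo (length ∘ slice k M) (suc M ∸ m * suc k))
          ≡⟨ cong sum (applyUpTo-cong (suc M ∸ m * suc k)
                        (λ j → List.length-map ((m * suc k + j) ∷_) (latticePoints k (M ∸ j)))) ⟩
        columnSum k M (suc M ∸ m * suc k)
          ≡⟨ cong (columnSum k M)
               (trans (ℕ.+-∸-assoc 1 (ℕ.m≤m+n (m * suc k) u)) (cong suc (ℕ.m+n∸m≡n (m * suc k) u))) ⟩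
        columnSum k M (suc u) ∎
        where
        open ≡-Reasoning
        M = m * suc k + u

    count-first : ∀ k → count (suc k) (m * suc k + 0) ≡ count k (m * suc k + 0)
    count-first k = trans (count-columnSum k 0) (ℕ.+-identityʳ _)

    count-next : ∀ k u → count (suc k) (m * suc k + suc u) ≡ count k (m * suc k + suc u) + count (suc k) (m * suc k + u)
    count-next k u = begin
      count (suc k) (m * suc k + suc u)
        ≡⟨ count-columnSum k (suc u) ⟩
      columnSum k (m * suc k + suc u) (suc (suc u))
        ≡⟨ cong (λ M → columnSum k M (suc (suc u))) (ℕ.+-suc (m * suc k) u) ⟩
      count k (suc (m * suc k + u)) + columnSum k (m * suc k + u) (suc u)
        ≡⟨ cong₂ _+_ (cong (count k) (sym (ℕ.+-suc (m * suc k) u))) (sym (count-columnSum k u)) ⟩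
      count k (m * suc k + suc u) + count (suc k) (m * suc k + u) ∎
      where open ≡-Reasoning

    scaledCount : ℕ → ℕ → ℕ
    scaledCount k u = suc k ! * count (suc k) (m * suc k + u)

    closedForm : ℕ → ℕ → ℕ
    closedForm k u = suc u * rising (m * suc k + u + 2) k

    private
      open ℕ-Solver

      lo+ : ∀ k u → m * suc (suc k) + u ≡ m * suc k + (m + u)
      lo+ k u = solve 3 (λ m k u → m :* (con 2 :+ k) :+ u := m :* (con 1 :+ k) :+ (m :+ u)) refl m k u

      scaledCount-zero-next : ∀ u → scaledCount 0 (suc u) ≡ 1 + scaledCount 0 u
      scaledCount-zero-next u = trans (cong (1 ! *_) (count-next 0 u)) (ℕ.*-distribˡ-+ (1 !) 1 _)

      scaledCount-first : ∀ k → scaledCount (suc k) 0 ≡ (2 + k) * scaledCount k m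
      scaledCount-first k = begin
        (2 + k) ! * count (2 + k) (m * (2 + k) + 0)   ≡⟨ cong ((2 + k) ! *_) (count-first (suc k)) ⟩
        (2 + k) ! * count (1 + k) (m * (2 + k) + 0)   ≡⟨ cong (λ M → (2 + k) ! * count (1 + k) M) (lo+ k 0) ⟩
        (2 + k) ! * count (1 + k) (m * (1 + k) + (m + 0))
          ≡⟨ cong (λ M → (2 + k) ! * count (1 + k) (m * (1 + k) + M)) (ℕ.+-identityʳ m) ⟩
        (2 + k) ! * count (1 + k) (m * (1 + k) + m)   ≡⟨ ℕ.*-assoc (2 + k) ((1 + k) !) _ ⟩
        (2 + k) * scaledCount k m                     ∎
        where open ≡-Reasoning

      scaledCount-next : ∀ k u → scaledCount (suc k) (suc u) ≡ (2 + k) * scaledCount k (m + suc u) + scaledCount (suc k) u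
      scaledCount-next k u = begin
        (2 + k) ! * count (2 + k) (m * (2 + k) + suc u)
          ≡⟨ cong ((2 + k) ! *_) (count-next (suc k) u) ⟩
        (2 + k) ! * (count (1 + k) (m * (2 + k) + suc u) + count (2 + k) (m * (2 + k) + u))
          ≡⟨ ℕ.*-distribˡ-+ ((2 + k) !) _ _ ⟩
        (2 + k) ! * count (1 + k) (m * (2 + k) + suc u) + scaledCount (suc k) u
          ≡⟨ cong (λ M → (2 + k) ! * count (1 + k) M + scaledCount (suc k) u) (lo+ k (suc u)) ⟩
        (2 + k) ! * count (1 + k) (m * (1 + k) + (m + suc u)) + scaledCount (suc k) u
          ≡⟨ cong (_+ scaledCount (suc k) u) (ℕ.*-assoc (2 + k) ((1 + k) !) _) ⟩
        (2 + k) * scaledCount k (m + suc u) + scaledCount (suc k) u ∎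
        where open ≡-Reasoning

      closedForm-zero-next : ∀ u → 1 + closedForm 0 u ≡ closedForm 0 (suc u)
      closedForm-zero-next u = solve 1 (λ u → con 1 :+ (con 1 :+ u) :* con 1 := (con 2 :+ u) :* con 1) refl u

      closedForm-first : ∀ k → (2 + k) * closedForm k m ≡ closedForm (suc k) 0
      closedForm-first k = begin
        (2 + k) * (suc m * rising (m * (1 + k) + m + 2) k)
          ≡⟨ cong (λ a → (2 + k) * (suc m * rising a k)) a≡ ⟩
        (2 + k) * (suc m * rising a k)
          ≡⟨ solve 3 (λ m k r → (con 2 :+ k) :* ((con 1 :+ m) :* r)
                              := con 1 :* (r :* ((m :* (con 2 :+ k) :+ con 0 :+ con 2) :+ k)))
               refl m k (rising a k) ⟩
        1 * (rising a k * (a + k))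
          ≡⟨ cong (1 *_) (sym (rising-snoc a k)) ⟩
        closedForm (suc k) 0 ∎
        where
        open ≡-Reasoning
        a = m * (2 + k) + 0 + 2
        a≡ : m * (1 + k) + m + 2 ≡ a
        a≡ = solve 2 (λ m k → m :* (con 1 :+ k) :+ m :+ con 2 := m :* (con 2 :+ k) :+ con 0 :+ con 2) refl m k

      closedForm-next : ∀ k u → (2 + k) * closedForm k (m + suc u) + closedForm (suc k) u ≡ closedForm (suc k) (suc u)
      closedForm-next k u = begin
        (2 + k) * (suc (m + suc u) * rising (m * (1 + k) + (m + suc u) + 2) k) + suc u * (b * rising (suc b) k)
          ≡⟨ cong (λ a → (2 + k) * (suc (m + suc u) * rising a k) + suc u * (b * rising (suc b) k)) a≡ ⟩
        (2 + k) * (suc (m + suc u) * rising (suc b) k) + suc u * (b * rising (suc b) k)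
          ≡⟨ solve 4 (λ m k u r → (con 2 :+ k) :* ((con 1 :+ (m :+ (con 1 :+ u))) :* r)
                                    :+ (con 1 :+ u) :* ((m :* (con 2 :+ k) :+ u :+ con 2) :* r)
                                  := (con 2 :+ u) :* (r :* ((con 1 :+ (m :* (con 2 :+ k) :+ u :+ con 2)) :+ k)))
               refl m k u (rising (suc b) k) ⟩
        suc (suc u) * (rising (suc b) k * (suc b + k))
          ≡⟨ cong (suc (suc u) *_) (sym (rising-snoc (suc b) k)) ⟩
        suc (suc u) * rising (suc b) (suc k)
          ≡⟨ cong (λ a → suc (suc u) * rising a (suc k)) b≡ ⟩
        closedForm (suc k) (suc u) ∎
        where
        open ≡-Reasoning
        b = m * (2 + k) + u + 2
        a≡ : m * (1 + k) + (m + suc u) + 2 ≡ suc b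
        a≡ = solve 3 (λ m k u → m :* (con 1 :+ k) :+ (m :+ (con 1 :+ u)) :+ con 2
                               := con 1 :+ (m :* (con 2 :+ k) :+ u :+ con 2))
               refl m k u
        b≡ : suc b ≡ m * (2 + k) + suc u + 2
        b≡ = solve 3 (λ m k u → con 1 :+ (m :* (con 2 :+ k) :+ u :+ con 2) := m :* (con 2 :+ k) :+ (con 1 :+ u) :+ con 2)
               refl m k u

    scaledCount≡closedForm : ∀ k u → scaledCount k u ≡ closedForm k u
    scaledCount≡closedForm zero    zero    = cong (1 ! *_) (count-first 0)
    scaledCount≡closedForm zero    (suc u) =
      trans (scaledCount-zero-next u) (trans (cong (1 +_) (scaledCount≡closedForm zero u)) (closedForm-zero-next u))
    scaledCount≡closedForm (suc k) zero    =
      trans (scaledCount-first k) (trans (cong ((2 + k) *_) (scaledCount≡closedForm k m)) (closedForm-first k))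
    scaledCount≡closedForm (suc k) (suc u) =
      trans (scaledCount-next k u)
        (trans (cong₂ (λ X Y → (2 + k) * X + Y)
                      (scaledCount≡closedForm k (m + suc u)) (scaledCount≡closedForm (suc k) u))
               (closedForm-next k u))

    integerPoints : ∀ k → ℕ → List (Vec ℤ (suc k))
    integerPoints k M = List.map (Vec.map (ℤ.+_)) (latticePoints k M)

    integerPoints-unique : ∀ k M → Unique (integerPoints k M)
    integerPoints-unique k M = Unique.map⁺ (Vec-map-injective ℤ.+-injective) (latticePoints-unique k M)

    ∈integerPoints⇔feasible : ∀ k M x →
      x ∈ integerPoints k M ⇔ Feasible k (ℕ→ℚ m) (ℕ→ℚ M) (Vec.map ℤ→ℚ x)
    ∈integerPoints⇔feasible k M x = mk⇔
      (λ x∈ → let v , v∈ , x≡ = ∈-map⁻ (Vec.map (ℤ.+_)) x∈ in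
              subst (Feasible k (ℕ→ℚ m) (ℕ→ℚ M) ∘ Vec.map ℤ→ℚ) (sym x≡) (∈latticePoints⇒feasible k M v v∈))
      (λ feasible → let v , v∈ , x≡ = feasible⇒∈latticePoints k M x feasible in
                    subst (_∈ integerPoints k M) (sym x≡) (∈-map⁺ (Vec.map (ℤ.+_)) v∈))

open import Defs
open Faces using (toPerm-isCombCube)
open Dilates using (inDilate⇔feasible)
open LatticePoints
open RisingFactorial using (rising; ehrProd≡rising)
open import Data.Nat as ℕ using (ℕ; suc; _≤_; _*_; _+_; _∸_; _!; s≤s; z≤n)
import Data.Nat.Properties as ℕ
open import Data.Nat.Solver using (module +-*-Solver)
import Data.List.Properties as List
open import Data.Product using (_×_; ∃-syntax; _,_)
import Function.Properties.Equivalence as ⇔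
open import Relation.Binary.PropositionalEquality

latticeCount : ∀ d m → LatticeCount (suc d) m (count m d (m * suc d))
latticeCount d m = integerPoints m d (m * suc d) , integerPoints-unique m d (m * suc d) ,
  (λ x → ⇔.trans (∈integerPoints⇔feasible m d (m * suc d) x) (⇔.sym (inDilate⇔feasible d m x))) ,
  List.length-map _ (latticePoints m d (m * suc d))

ehrhart : ∀ k m → suc k ! * count m (suc k) (m * (2 + k)) ≡ (m + 1) * ehrProd (2 + k) m
ehrhart k m = begin
  suc k ! * count m (suc k) (m * (2 + k))   ≡⟨ cong (λ M → suc k ! * count m (suc k) M) M≡ ⟩
  scaledCount m k m                          ≡⟨ scaledCount≡closedForm m k m ⟩
  suc m * rising (m * suc k + m + 2) k       ≡⟨ cong₂ (λ a b → a * rising b k) (ℕ.+-comm 1 m) b≡ ⟩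
  (m + 1) * rising ((2 + k) * m + 2) k       ≡⟨ cong ((m + 1) *_) (ehrProd≡rising k m) ⟨
  (m + 1) * ehrProd (2 + k) m                ∎
  where
  open ≡-Reasoning
  open +-*-Solver
  M≡ : m * (2 + k) ≡ m * suc k + m
  M≡ = solve 2 (λ m k → m :* (con 2 :+ k) := m :* (con 1 :+ k) :+ m) refl m k
  b≡ : m * suc k + m + 2 ≡ (2 + k) * m + 2
  b≡ = solve 2 (λ m k → m :* (con 1 :+ k) :+ m :+ con 2 := (con 2 :+ k) :* m :+ con 2) refl m k

theorem3p16 : (n : ℕ) → 2 ≤ n →
    IsCombCube n ×
    (∀ (m : ℕ) → ∃[ N ] (LatticeCount n m N × ((n ∸ 1) ! * N ≡ (m + 1) * ehrProd n m)))
theorem3p16 (suc (suc k)) (s≤s (s≤s z≤n)) =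
  toPerm-isCombCube (suc k) , λ m → count m (suc k) (m * (2 + k)) , latticeCount (suc k) m , ehrhart k m
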